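{- For every positive integer $n>2$ there exists a prime number $p$ with $4n<p<5n$. -}

module Defs where

module Submission where

-- Positive integers are handled through prime exponents: primeProduct e N is
-- the product of p ^ e p over the primes p ≤ N, and Legendre's formula writes m!
-- this way with exponents Σ_k ⌊m/p^k⌋.  Replacing ⌊y⌋ there by the weight
--   chebyshev y = ⌊y⌋ + ⌊y/30⌋ - ⌊y/2⌋ - ⌊y/3⌋ - ⌊y/5⌋   ∈ {0, 1}
-- gives Γ x, with Γ(30m) = (30m)! m! / ((15m)! (10m)! (6m)!); replacing it by
-- the indicator of y ≥ 1 gives Ψ x = lcm(1, …, x).  Two-sided estimates of
-- binomial coefficients place Γ(30m) · Den^m between Num^m / poly(m) and
-- Num^m · poly(m).  As chebyshev ≤ 1, and chebyshev = 1 on [1, 5], we get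
-- Γ ≤ Ψ and Ψ(30c) ≤ Γ(30c) Ψ(5c), hence Chebyshev's bound Ψ x ≤ K · 4^(x+29).
-- If (4n, 5n] had no prime, then Ψ(5n) ≤ Ψ(4n) Ψ(√(5n)); chaining the estimates
-- yields Num^t ≤ Den^t · (subexponential), false for n ≥ 40410 (no-gap-large).
-- For 2 < n < 40410 a chain of 44 explicit primes suffices (small-cases).

open import Defs
open import Data.Nat using (ℕ; _*_; _<_)
open import Data.Nat.Primality using (Prime)
open import Data.Product using (∃; _×_)

open import Data.Nat.Base
open import Data.Nat.Properties
open import Data.Nat.DivMod
open import Data.Nat.Divisibility
open import Data.Nat.Primality
open import Data.Nat.Primality.Factorisation using (factorise)
open import Data.Nat.ListAction using (product)
open import Data.Nat.Tactic.RingSolver using (solve-∀)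
open import Data.Bool.Base using (Bool; false; T; _∧_; _∨_; not)
open import Data.Bool.Properties using (T-∧; T-∨; T-not-≡)
open import Function.Bundles using (Equivalence)
open import Data.Unit.Base using (tt)
open import Data.Product using (_,_; proj₁; proj₂; Σ)
open import Data.Sum using (_⊎_; inj₁; inj₂)
open import Data.Empty using (⊥; ⊥-elim)
open import Data.List.Base using (List; []; _∷_)
open import Data.List.Relation.Unary.All using (All; []; _∷_)
open import Function.Base using (id)
open import Relation.Nullary using (¬_; yes; no; contradiction)
open import Relation.Nullary.Decidable using (toWitness; _×-dec_)
open import Relation.Binary.PropositionalEquality

^-distribʳ-* : ∀ a b k → (a * b) ^ k ≡ a ^ k * b ^ k
^-distribʳ-* a b zero = refl
^-distribʳ-* a b (suc k) = begin
  a * b * (a * b) ^ k       ≡⟨ cong (a * b *_) (^-distribʳ-* a b k) ⟩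
  a * b * (a ^ k * b ^ k)   ≡⟨ interchange a b (a ^ k) (b ^ k) ⟩
  a * a ^ k * (b * b ^ k)   ∎
  where
  open ≡-Reasoning
  interchange : ∀ a b x y → a * b * (x * y) ≡ a * x * (b * y)
  interchange = solve-∀

divSum : ℕ → ℕ
divSum y = y / 2 + y / 3 + y / 5

chebyshev : ℕ → ℕ
chebyshev y = (y + y / 30) ∸ divSum y

/-period : ∀ y k d .{{_ : NonZero d}} → k * d ≡ 30 → y / d ≡ (y / 30) * k + (y % 30) / d
/-period y k d kd≡30 = begin
  y / d                                 ≡⟨ /-congˡ (m≡m%n+[m/n]*n y 30) ⟩
  (y % 30 + (y / 30) * 30) / d          ≡⟨ /-congˡ (cong (λ z → y % 30 + (y / 30) * z) (sym kd≡30)) ⟩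
  (y % 30 + (y / 30) * (k * d)) / d     ≡⟨ /-congˡ (cong (y % 30 +_) (sym (*-assoc (y / 30) k d))) ⟩
  (y % 30 + (y / 30) * k * d) / d       ≡⟨ +-distrib-/-∣ʳ (y % 30) (divides-refl ((y / 30) * k)) ⟩
  (y % 30) / d + (y / 30) * k * d / d   ≡⟨ cong ((y % 30) / d +_) (m*n/n≡m ((y / 30) * k) d) ⟩
  (y % 30) / d + (y / 30) * k           ≡⟨ +-comm ((y % 30) / d) ((y / 30) * k) ⟩
  (y / 30) * k + (y % 30) / d           ∎
  where open ≡-Reasoning

-- Both halves of the weight grow by exactly 31 per period of 30 ...
divSum-period : ∀ y → divSum y ≡ (y / 30) * 31 + divSum (y % 30)
divSum-period y = begin
  y / 2 + y / 3 + y / 5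
    ≡⟨ cong₂ _+_ (cong₂ _+_ (/-period y 15 2 refl) (/-period y 10 3 refl)) (/-period y 6 5 refl) ⟩
  q * 15 + (r / 2) + (q * 10 + r / 3) + (q * 6 + r / 5)
    ≡⟨ regroup q (r / 2) (r / 3) (r / 5) ⟩
  q * 31 + divSum r ∎
  where
  open ≡-Reasoning
  q = y / 30
  r = y % 30
  regroup : ∀ q a b c → q * 15 + a + (q * 10 + b) + (q * 6 + c) ≡ q * 31 + (a + b + c)
  regroup = solve-∀

top-period : ∀ y → y + y / 30 ≡ (y / 30) * 31 + y % 30
top-period y = begin
  y + y / 30                         ≡⟨ cong (_+ y / 30) (m≡m%n+[m/n]*n y 30) ⟩
  y % 30 + (y / 30) * 30 + y / 30    ≡⟨ regroup (y % 30) (y / 30) ⟩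
  (y / 30) * 31 + y % 30             ∎
  where
  open ≡-Reasoning
  regroup : ∀ r q → r + q * 30 + q ≡ q * 31 + r
  regroup = solve-∀

-- ... so the weight is periodic, and one period is a finite check.
residue-table : ∀ {r} → r < 30 → divSum r ≤ r × r ∸ divSum r ≤ 1
residue-table = toWitness {a? = allUpTo? (λ r → divSum r ≤? r ×-dec r ∸ divSum r ≤? 1) 30} tt

divSum≤top : ∀ y → divSum y ≤ y + y / 30
divSum≤top y = begin
  divSum y                      ≡⟨ divSum-period y ⟩
  (y / 30) * 31 + divSum (y % 30) ≤⟨ +-monoʳ-≤ ((y / 30) * 31) (proj₁ (residue-table (m%n<n y 30))) ⟩
  (y / 30) * 31 + y % 30        ≡⟨ top-period y ⟨
  y + y / 30                    ∎
  where open ≤-Reasoning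

-- The defining identity of the weight, without truncated subtraction.
chebyshev-identity : ∀ y → chebyshev y + divSum y ≡ y + y / 30
chebyshev-identity y = m∸n+n≡m (divSum≤top y)

chebyshev≤1 : ∀ y → chebyshev y ≤ 1
chebyshev≤1 y = begin
  (y + y / 30) ∸ divSum y                             ≡⟨ cong₂ _∸_ (top-period y) (divSum-period y) ⟩
  (q * 31 + y % 30) ∸ (q * 31 + divSum (y % 30))      ≡⟨ [m+n]∸[m+o]≡n∸o (q * 31) (y % 30) (divSum (y % 30)) ⟩
  y % 30 ∸ divSum (y % 30)                            ≤⟨ proj₂ (residue-table (m%n<n y 30)) ⟩
  1                                                   ∎
  where
  open ≤-Reasoning
  q = y / 30

chebyshev-small : ∀ y → 1 ≤ y → y ≤ 5 → chebyshev y ≡ 1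
chebyshev-small 1 _ _ = refl
chebyshev-small 2 _ _ = refl
chebyshev-small 3 _ _ = refl
chebyshev-small 4 _ _ = refl
chebyshev-small 5 _ _ = refl
chebyshev-small (suc (suc (suc (suc (suc (suc _)))))) _ (s≤s (s≤s (s≤s (s≤s (s≤s ())))))

-- The indicator of y ≥ 1: the weight whose Legendre sums count prime powers.
positive : ℕ → ℕ
positive zero = 0
positive (suc _) = 1

positive-mono : ∀ {y y'} → y ≤ y' → positive y ≤ positive y'
positive-mono {zero} _ = z≤n
positive-mono {suc _} {suc _} _ = ≤-refl

positive≤1 : ∀ y → positive y ≤ 1
positive≤1 zero = z≤n
positive≤1 (suc _) = ≤-refl

-- Legendre sums with weight φ: adicSum φ q m B = Σ_{k=1}^{B} φ ⌊m / q^k⌋.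
-- (The cut-off B is later taken ≥ m, so that no terms are missing.)
adicSum : (ℕ → ℕ) → ℕ → ℕ → ℕ → ℕ
adicSum φ zero m B = 0
adicSum φ (suc q) m zero = 0
adicSum φ (suc q) m (suc B) = φ (m / suc q) + adicSum φ (suc q) (m / suc q) B

adicSum-+ : ∀ φ ψ q m B → adicSum (λ y → φ y + ψ y) q m B ≡ adicSum φ q m B + adicSum ψ q m B
adicSum-+ φ ψ zero m B = refl
adicSum-+ φ ψ (suc q) m zero = refl
adicSum-+ φ ψ (suc q) m (suc B) rewrite adicSum-+ φ ψ (suc q) (m / suc q) B =
  interchange (φ (m / suc q)) (ψ (m / suc q)) (adicSum φ (suc q) (m / suc q) B) (adicSum ψ (suc q) (m / suc q) B)
  where
  interchange : ∀ a b c d → a + b + (c + d) ≡ a + c + (b + d)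
  interchange = solve-∀

adicSum-cong : ∀ φ ψ q m B → (∀ y → φ y ≡ ψ y) → adicSum φ q m B ≡ adicSum ψ q m B
adicSum-cong φ ψ zero m B h = refl
adicSum-cong φ ψ (suc q) m zero h = refl
adicSum-cong φ ψ (suc q) m (suc B) h = cong₂ _+_ (h (m / suc q)) (adicSum-cong φ ψ (suc q) (m / suc q) B h)

adicSum-mono : ∀ φ ψ q m B → (∀ y → φ y ≤ ψ y) → adicSum φ q m B ≤ adicSum ψ q m B
adicSum-mono φ ψ zero m B h = z≤n
adicSum-mono φ ψ (suc q) m zero h = z≤n
adicSum-mono φ ψ (suc q) m (suc B) h = +-mono-≤ (h (m / suc q)) (adicSum-mono φ ψ (suc q) (m / suc q) B h)

adicSum-monoᵐ : ∀ φ q m m' B → (∀ {y y'} → y ≤ y' → φ y ≤ φ y') → m ≤ m' → adicSum φ q m B ≤ adicSum φ q m' B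
adicSum-monoᵐ φ zero m m' B φ-mono m≤m' = z≤n
adicSum-monoᵐ φ (suc q) m m' zero φ-mono m≤m' = z≤n
adicSum-monoᵐ φ (suc q) m m' (suc B) φ-mono m≤m' =
  +-mono-≤ (φ-mono m/q≤m'/q) (adicSum-monoᵐ φ (suc q) (m / suc q) (m' / suc q) B φ-mono m/q≤m'/q)
  where m/q≤m'/q = /-monoˡ-≤ (suc q) m≤m'

adicSum-monoᴮ : ∀ φ q m B → adicSum φ q m B ≤ adicSum φ q m (suc B)
adicSum-monoᴮ φ zero m B = z≤n
adicSum-monoᴮ φ (suc q) m zero = z≤n
adicSum-monoᴮ φ (suc q) m (suc B) = +-monoʳ-≤ (φ (m / suc q)) (adicSum-monoᴮ φ (suc q) (m / suc q) B)

/-comm : ∀ m d q .{{_ : NonZero d}} .{{_ : NonZero q}} → m / d / q ≡ m / q / d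
/-comm m d q {{nd}} {{nq}} = begin
  m / d / q        ≡⟨ m/n/o≡m/[n*o] m d q {{nd}} {{nq}} {{m*n≢0 d q}} ⟩
  (m / (d * q)) {{m*n≢0 d q}} ≡⟨ /-congʳ {{m*n≢0 d q}} {{m*n≢0 q d}} (*-comm d q) ⟩
  (m / (q * d)) {{m*n≢0 q d}} ≡⟨ m/n/o≡m/[n*o] m q d {{nq}} {{nd}} {{m*n≢0 q d}} ⟨
  m / q / d        ∎
  where open ≡-Reasoning

adicSum-/ : ∀ φ q m B d .{{_ : NonZero d}} → adicSum φ q (m / d) B ≡ adicSum (λ y → φ (y / d)) q m B
adicSum-/ φ zero m B d = refl
adicSum-/ φ (suc q) m zero d = refl
adicSum-/ φ (suc q) m (suc B) d {{nd}} rewrite /-comm m d (suc q) {{nd}} {{_}} =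
  cong (φ (m / suc q / d) +_) (adicSum-/ φ (suc q) (m / suc q) B d)

adicSum-zero : ∀ φ q B → φ 0 ≡ 0 → adicSum φ q 0 B ≡ 0
adicSum-zero φ zero B φ0 = refl
adicSum-zero φ (suc q) zero φ0 = refl
adicSum-zero φ (suc q) (suc B) φ0 rewrite φ0 = adicSum-zero φ (suc q) B φ0

adicSum-small : ∀ φ q m B → φ 0 ≡ 0 → m < q → adicSum φ q m B ≡ 0
adicSum-small φ zero m B φ0 m<q = refl
adicSum-small φ (suc q) m zero φ0 m<q = refl
adicSum-small φ (suc q) m (suc B) φ0 m<q rewrite m<n⇒m/n≡0 m<q | φ0 = adicSum-zero φ (suc q) B φ0

-- Every prime is of the form 2 + q; many definitions below need q ≥ 2.
prime⇒2+ : ∀ {q} → Prime q → Σ ℕ (λ q' → q ≡ 2 + q')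
prime⇒2+ {zero} pq = ⊥-elim (¬prime[0] pq)
prime⇒2+ {suc zero} pq = ⊥-elim (¬prime[1] pq)
prime⇒2+ {suc (suc q')} pq = q' , refl

valuation : ℕ → ℕ → ℕ → ℕ
valuation zero n B = 0
valuation (suc q) n zero = 0
valuation (suc q) n (suc B) with suc q ∣? n
... | yes _ = suc (valuation (suc q) (n / suc q) B)
... | no _ = 0

/-suc : ∀ m q .{{_ : NonZero q}} → (q ∣ suc m × suc m / q ≡ suc (m / q)) ⊎ (¬ (q ∣ suc m) × suc m / q ≡ m / q)
/-suc m q with suc (m % q) ≟ q
... | yes wrap = inj₁ (divides (suc (m / q)) sm≡ , trans (/-congˡ sm≡) (m*n/n≡m (suc (m / q)) q))
  where
  sm≡ : suc m ≡ suc (m / q) * q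
  sm≡ = begin
    suc m                   ≡⟨ cong suc (m≡m%n+[m/n]*n m q) ⟩
    suc (m % q) + m / q * q ≡⟨ cong (_+ m / q * q) wrap ⟩
    q + m / q * q           ∎
    where open ≡-Reasoning
... | no ¬wrap = inj₂ (q∤sm , sm/q≡m/q)
  where
  lt : suc (m % q) < q
  lt = ≤∧≢⇒< (m%n<n m q) ¬wrap
  sm≡ : suc m ≡ suc (m % q) + m / q * q
  sm≡ = cong suc (m≡m%n+[m/n]*n m q)
  sm%q≡ : suc m % q ≡ suc (m % q)
  sm%q≡ = begin
    suc m % q                         ≡⟨ %-congˡ sm≡ ⟩
    (suc (m % q) + m / q * q) % q     ≡⟨ [m+kn]%n≡m%n (suc (m % q)) (m / q) q ⟩
    suc (m % q) % q                   ≡⟨ m<n⇒m%n≡m lt ⟩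
    suc (m % q)                       ∎
    where open ≡-Reasoning
  q∤sm : ¬ (q ∣ suc m)
  q∤sm q∣sm = 0≢1+n (trans (sym (n∣m⇒m%n≡0 (suc m) q q∣sm)) sm%q≡)
  sm/q≡m/q : suc m / q ≡ m / q
  sm/q≡m/q = begin
    suc m / q                                ≡⟨ /-congˡ sm≡ ⟩
    (suc (m % q) + m / q * q) / q            ≡⟨ +-distrib-/-∣ʳ (suc (m % q)) (divides-refl (m / q)) ⟩
    suc (m % q) / q + m / q * q / q          ≡⟨ cong₂ _+_ (m<n⇒m/n≡0 lt) (m*n/n≡m (m / q) q) ⟩
    m / q                                    ∎
    where open ≡-Reasoning

adicSum-suc : ∀ q m B → adicSum id q (suc m) B ≡ adicSum id q m B + valuation q (suc m) B
adicSum-suc zero m B = refl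
adicSum-suc (suc q) m zero = refl
adicSum-suc (suc q) m (suc B) with suc q ∣? suc m | /-suc m (suc q)
... | yes _ | inj₁ (_ , sm/q≡) rewrite sm/q≡ | adicSum-suc (suc q) (m / suc q) B =
  shift (m / suc q) (adicSum id (suc q) (m / suc q) B) (valuation (suc q) (suc (m / suc q)) B)
  where
  shift : ∀ a s v → suc a + (s + v) ≡ a + s + suc v
  shift = solve-∀
... | yes q∣sm | inj₂ (q∤sm , _) = contradiction q∣sm q∤sm
... | no q∤sm  | inj₁ (q∣sm , _) = contradiction q∣sm q∤sm
... | no _     | inj₂ (_ , sm/q≡) rewrite sm/q≡ = sym (+-identityʳ _)

valuation-depth : ∀ q n B → 1 ≤ n → n ≤ B → valuation (2 + q) n B ≡ valuation (2 + q) n (suc B)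
valuation-depth q n (suc B) n≥1 n≤B with 2 + q ∣? n
... | no _ = refl
... | yes q∣n = cong suc (valuation-depth q (n / (2 + q)) B (m≥n⇒m/n>0 (∣⇒≤ {{>-nonZero n≥1}} q∣n)) n/q≤B)
  where
  n/q≤B : n / (2 + q) ≤ B
  n/q≤B = ≤-pred (≤-trans (m/n<m n (2 + q) {{>-nonZero n≥1}} (s≤s (s≤s z≤n))) n≤B)
valuation-depth q (suc n) zero n≥1 ()

valuation-*self : ∀ q r B → valuation (2 + q) ((2 + q) * r) (suc B) ≡ suc (valuation (2 + q) r B)
valuation-*self q r B with 2 + q ∣? ((2 + q) * r)
... | yes _ = cong (λ z → suc (valuation (2 + q) z B)) (trans (/-congˡ (*-comm (2 + q) r)) (m*n/n≡m r (2 + q)))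
... | no q∤qr = ⊥-elim (q∤qr (divides r (*-comm (2 + q) r)))

valuation-1 : ∀ q B → valuation (2 + q) 1 B ≡ 0
valuation-1 q zero = refl
valuation-1 q (suc B) with 2 + q ∣? 1
... | yes q∣1 with () ← ∣1⇒≡1 q∣1
... | no _ = refl

valuation-*other : ∀ q p r B → Prime (2 + q) → Prime p → 2 + q ≢ p → valuation (2 + q) (p * r) B ≡ valuation (2 + q) r B
valuation-*other q p r zero pq pp q≢p = refl
valuation-*other q p r (suc B) pq pp q≢p with 2 + q ∣? (p * r) | 2 + q ∣? r
... | yes _ | yes q∣r rewrite *-/-assoc p q∣r = cong suc (valuation-*other q p (r / (2 + q)) B pq pp q≢p)
... | yes q∣pr | no q∤r with euclidsLemma p r pq q∣pr
...   | inj₂ q∣r = ⊥-elim (q∤r q∣r)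
...   | inj₁ q∣p with prime⇒irreducible pp q∣p
...     | inj₁ ()
...     | inj₂ q≡p = ⊥-elim (q≢p q≡p)
valuation-*other q p r (suc B) pq pp q≢p | no q∤pr | yes q∣r = ⊥-elim (q∤pr (∣-trans q∣r (divides p refl)))
valuation-*other q p r (suc B) pq pp q≢p | no _ | no _ = refl

-- Numbers given by their prime exponents: primeProduct e N = Π_{p ≤ N prime} p ^ e p.
primePower : (ℕ → ℕ) → ℕ → ℕ
primePower e q with prime? q
... | yes _ = q ^ e q
... | no _ = 1

primeProduct : (ℕ → ℕ) → ℕ → ℕ
primeProduct e zero = 1
primeProduct e (suc N) = primeProduct e N * primePower e (suc N)

primeProduct-cong : ∀ e e' N → (∀ q → Prime q → e q ≡ e' q) → primeProduct e N ≡ primeProduct e' N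
primeProduct-cong e e' zero h = refl
primeProduct-cong e e' (suc N) h = cong₂ _*_ (primeProduct-cong e e' N h) (power (suc N) (h (suc N)))
  where
  power : ∀ q → (Prime q → e q ≡ e' q) → primePower e q ≡ primePower e' q
  power q h with prime? q
  ... | yes pq = cong (q ^_) (h pq)
  ... | no _ = refl

primePower-+ : ∀ e e' q → primePower (λ x → e x + e' x) q ≡ primePower e q * primePower e' q
primePower-+ e e' q with prime? q
... | yes _ = ^-distribˡ-+-* q (e q) (e' q)
... | no _ = refl

primeProduct-+ : ∀ e e' N → primeProduct (λ x → e x + e' x) N ≡ primeProduct e N * primeProduct e' N
primeProduct-+ e e' zero = refl
primeProduct-+ e e' (suc N) rewrite primeProduct-+ e e' N | primePower-+ e e' (suc N) =
  interchange (primeProduct e N) (primeProduct e' N) (primePower e (suc N)) (primePower e' (suc N))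
  where
  interchange : ∀ a b c d → a * b * (c * d) ≡ a * c * (b * d)
  interchange = solve-∀

primeProduct-mono : ∀ e e' N → (∀ q → Prime q → e q ≤ e' q) → primeProduct e N ≤ primeProduct e' N
primeProduct-mono e e' zero h = ≤-refl
primeProduct-mono e e' (suc N) h = *-mono-≤ (primeProduct-mono e e' N h) (power (suc N) (h (suc N)))
  where
  power : ∀ q → (Prime q → e q ≤ e' q) → primePower e q ≤ primePower e' q
  power q h with prime? q
  ... | yes pq = ^-monoʳ-≤ q {{prime⇒nonZero pq}} (h pq)
  ... | no _ = ≤-refl

primePower-trivial : ∀ e q → (Prime q → e q ≡ 0) → primePower e q ≡ 1
primePower-trivial e q h with prime? q
... | yes pq rewrite h pq = refl
... | no _ = refl

primeProduct-trivial : ∀ e N → (∀ q → 1 ≤ q → q ≤ N → Prime q → e q ≡ 0) → primeProduct e N ≡ 1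
primeProduct-trivial e zero h = refl
primeProduct-trivial e (suc N) h
  rewrite primeProduct-trivial e N (λ q q≥1 q≤N → h q q≥1 (m≤n⇒m≤1+n q≤N))
        | primePower-trivial e (suc N) (h (suc N) (s≤s z≤n) ≤-refl) = refl

primeProduct-extend : ∀ e N d → (∀ q → N < q → Prime q → e q ≡ 0) → primeProduct e (d + N) ≡ primeProduct e N
primeProduct-extend e N zero h = refl
primeProduct-extend e N (suc d) h
  rewrite primeProduct-extend e N d h
        | primePower-trivial e (suc (d + N)) (h (suc (d + N)) (s≤s (m≤n+m N d))) = *-identityʳ (primeProduct e N)

primeProduct-bound : ∀ e N x → 1 ≤ x → (∀ q → q ≤ N → Prime q → q ^ e q ≤ x) → primeProduct e N ≤ x ^ N
primeProduct-bound e zero x x≥1 h = ≤-refl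
primeProduct-bound e (suc N) x x≥1 h = begin
  primeProduct e N * primePower e (suc N)
    ≤⟨ *-mono-≤ (primeProduct-bound e N x x≥1 (λ q q≤N → h q (m≤n⇒m≤1+n q≤N))) (power (h (suc N) ≤-refl)) ⟩
  x ^ N * x ≡⟨ *-comm (x ^ N) x ⟩
  x ^ suc N ∎
  where
  open ≤-Reasoning
  power : (Prime (suc N) → suc N ^ e (suc N) ≤ x) → primePower e (suc N) ≤ x
  power h with prime? (suc N)
  ... | yes pq = h pq
  ... | no _ = x≥1

-- The exponent vector of a single prime p.
δ : ℕ → ℕ → ℕ
δ p q with q ≟ p
... | yes _ = 1
... | no _ = 0

δ-same : ∀ p → δ p p ≡ 1
δ-same p with p ≟ p
... | yes _ = refl
... | no p≢p = ⊥-elim (p≢p refl)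

δ-diff : ∀ p q → q ≢ p → δ p q ≡ 0
δ-diff p q q≢p with q ≟ p
... | yes q≡p = ⊥-elim (q≢p q≡p)
... | no _ = refl

primeProduct-δ : ∀ p N → Prime p → p ≤ N → primeProduct (δ p) N ≡ p
primeProduct-δ .0 zero pp z≤n = ⊥-elim (¬prime[0] pp)
primeProduct-δ p (suc N) pp p≤sN with m≤n⇒m<n∨m≡n p≤sN
... | inj₁ p<sN rewrite primeProduct-δ p N pp (≤-pred p<sN)
                      | primePower-trivial (δ p) (suc N) (λ _ → δ-diff p (suc N) (λ e → <-irrefl (sym e) p<sN)) = *-identityʳ p
... | inj₂ refl rewrite primeProduct-trivial (δ (suc N)) N (λ q _ q≤N _ → δ-diff (suc N) q (λ e → <-irrefl e (s≤s q≤N))) = top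
  where
  top : 1 * primePower (δ (suc N)) (suc N) ≡ suc N
  top with prime? (suc N)
  ... | yes _ rewrite δ-same (suc N) = trans (+-identityʳ _) (*-identityʳ (suc N))
  ... | no ¬p = ⊥-elim (¬p pp)

factorisation-list : ∀ L N → All Prime L → product L ≤ N → primeProduct (λ q → valuation q (product L) N) N ≡ product L
factorisation-list [] N [] _ = trans (primeProduct-cong _ (λ _ → 0) N v≡0) (primeProduct-trivial (λ _ → 0) N (λ _ _ _ _ → refl))
  where
  v≡0 : ∀ q → Prime q → valuation q 1 N ≡ 0
  v≡0 q pq with prime⇒2+ pq
  ... | q' , refl = valuation-1 q' N
factorisation-list (p ∷ L) N (pp ∷ pL) pr≤N = begin
  primeProduct (λ q → valuation q (p * r) N) N               ≡⟨ primeProduct-cong _ _ N peel ⟩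
  primeProduct (λ q → δ p q + valuation q r N) N             ≡⟨ primeProduct-+ (δ p) (λ q → valuation q r N) N ⟩
  primeProduct (δ p) N * primeProduct (λ q → valuation q r N) N
                                                             ≡⟨ cong₂ _*_ (primeProduct-δ p N pp p≤N) (factorisation-list L N pL r≤N) ⟩
  p * r                                                      ∎
  where
  open ≡-Reasoning
  r = product L
  r≥1 : 1 ≤ r
  r≥1 = productOfPrimes≥1 pL
  p≤N : p ≤ N
  p≤N = ≤-trans (m≤m*n p r {{>-nonZero r≥1}}) pr≤N
  r<pr : r < p * r
  r<pr = subst (r <_) (*-comm r p) (m<m*n r p {{>-nonZero r≥1}} (nonTrivial⇒n>1 p {{prime⇒nonTrivial pp}}))
  r≤N : r ≤ N
  r≤N = ≤-trans (<⇒≤ r<pr) pr≤N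
  peel : ∀ q → Prime q → valuation q (p * r) N ≡ δ p q + valuation q r N
  peel q pq with q ≟ p | prime⇒2+ pq
  peel q pq | yes refl | q' , refl = self N r<pr pr≤N
    where
    self : ∀ M → r < (2 + q') * r → (2 + q') * r ≤ M → valuation (2 + q') ((2 + q') * r) M ≡ suc (valuation (2 + q') r M)
    self (suc M) _ pr≤sM = trans (valuation-*self q' r M) (cong suc (valuation-depth q' r M r≥1 (≤-pred (≤-trans r<pr pr≤sM))))
    self zero r<pr pr≤0 = ⊥-elim (<-irrefl refl (≤-trans r<pr (≤-trans pr≤0 z≤n)))
  peel q pq | no q≢p | q' , refl = valuation-*other q' p r N pq pp q≢p

factorisation : ∀ n N → 1 ≤ n → n ≤ N → primeProduct (λ q → valuation q n N) N ≡ n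
factorisation n N n≥1 n≤N with factorise n {{>-nonZero n≥1}}
... | record { factors = L ; isFactorisation = L≡n ; factorsPrime = pL } rewrite L≡n = factorisation-list L N pL n≤N

legendre : ∀ m N → m ≤ N → m ! ≡ primeProduct (λ q → adicSum id q m N) N
legendre zero N _ = sym (primeProduct-trivial _ N (λ q _ _ _ → adicSum-zero id q N refl))
legendre (suc m) N sm≤N = begin
  suc m * m !
    ≡⟨ cong₂ _*_ (sym (factorisation (suc m) N (s≤s z≤n) sm≤N)) (legendre m N (≤-trans (n≤1+n m) sm≤N)) ⟩
  primeProduct (λ q → valuation q (suc m) N) N * primeProduct (λ q → adicSum id q m N) N
    ≡⟨ *-comm (primeProduct (λ q → valuation q (suc m) N) N) _ ⟩
  primeProduct (λ q → adicSum id q m N) N * primeProduct (λ q → valuation q (suc m) N) N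
    ≡⟨ primeProduct-+ _ _ N ⟨
  primeProduct (λ q → adicSum id q m N + valuation q (suc m) N) N
    ≡⟨ primeProduct-cong _ _ N (λ q _ → sym (adicSum-suc q m N)) ⟩
  primeProduct (λ q → adicSum id q (suc m) N) N ∎
  where open ≡-Reasoning

-- Binomial coefficients indexed by the two parts: binom k l = (k + l)! / (k! l!).
binom : ℕ → ℕ → ℕ
binom zero l = 1
binom (suc k) zero = 1
binom (suc k) (suc l) = binom k (suc l) + binom (suc k) l

binom-factorial : ∀ k l → binom k l * (k ! * l !) ≡ (k + l) !
binom-factorial zero l = trans (+-identityʳ _) (+-identityʳ _)
binom-factorial (suc k) zero = trans (+-identityʳ _) (trans (*-identityʳ _) (cong _! (sym (+-identityʳ (suc k)))))
binom-factorial (suc k) (suc l) = begin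
  (A + C) * (suc k * x * (suc l * y))
    ≡⟨ pascal A C x y (suc k) (suc l) ⟩
  suc k * (A * (x * (suc l * y))) + suc l * (C * (suc k * x * y))
    ≡⟨ cong₂ (λ u v → suc k * u + suc l * v) (binom-factorial k (suc l)) (binom-factorial (suc k) l) ⟩
  suc k * (k + suc l) ! + suc l * (suc k + l) !
    ≡⟨ cong (λ z → suc k * z ! + suc l * F) (+-suc k l) ⟩
  suc k * F + suc l * F
    ≡⟨ *-distribʳ-+ F (suc k) (suc l) ⟨
  (suc k + suc l) * F
    ≡⟨ cong (λ z → suc (k + suc l) * z !) (+-suc k l) ⟨
  (suc k + suc l) ! ∎
  where
  open ≡-Reasoning
  A = binom k (suc l)
  C = binom (suc k) l
  x = k !
  y = l !
  F = (suc k + l) !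
  pascal : ∀ A C x y a b → (A + C) * (a * x * (b * y)) ≡ a * (A * (x * (b * y))) + b * (C * (a * x * y))
  pascal = solve-∀

-- Sums over an antidiagonal: diagSum f n = Σ_{i + j = n} f i j.
diagSum : (ℕ → ℕ → ℕ) → ℕ → ℕ
diagSum f zero = f 0 0
diagSum f (suc n) = f 0 (suc n) + diagSum (λ i j → f (suc i) j) n

diagSum-cong : ∀ f g n → (∀ i j → f i j ≡ g i j) → diagSum f n ≡ diagSum g n
diagSum-cong f g zero h = h 0 0
diagSum-cong f g (suc n) h = cong₂ _+_ (h 0 (suc n)) (diagSum-cong _ _ n (λ i j → h (suc i) j))

diagSum-+ : ∀ f g n → diagSum (λ i j → f i j + g i j) n ≡ diagSum f n + diagSum g n
diagSum-+ f g zero = refl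
diagSum-+ f g (suc n) rewrite diagSum-+ (λ i j → f (suc i) j) (λ i j → g (suc i) j) n =
  interchange (f 0 (suc n)) (g 0 (suc n)) (diagSum (λ i j → f (suc i) j) n) (diagSum (λ i j → g (suc i) j) n)
  where
  interchange : ∀ a b c d → a + b + (c + d) ≡ a + c + (b + d)
  interchange = solve-∀

diagSum-* : ∀ c f n → c * diagSum f n ≡ diagSum (λ i j → c * f i j) n
diagSum-* c f zero = refl
diagSum-* c f (suc n) = trans (*-distribˡ-+ c (f 0 (suc n)) _) (cong (c * f 0 (suc n) +_) (diagSum-* c (λ i j → f (suc i) j) n))

shiftˡ shiftʳ : (ℕ → ℕ → ℕ) → ℕ → ℕ → ℕ
shiftˡ u zero j = 0
shiftˡ u (suc i) j = u i j
shiftʳ v i zero = 0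
shiftʳ v i (suc j) = v i j

diagSum-shiftʳ : ∀ v n → diagSum (shiftʳ v) (suc n) ≡ diagSum v n
diagSum-shiftʳ v zero = +-identityʳ (v 0 0)
diagSum-shiftʳ v (suc n) =
  cong (v 0 (suc n) +_) (trans (diagSum-cong _ (shiftʳ (λ i j → v (suc i) j)) (suc n) shift-suc) (diagSum-shiftʳ (λ i j → v (suc i) j) n))
  where
  shift-suc : ∀ i j → shiftʳ v (suc i) j ≡ shiftʳ (λ i j → v (suc i) j) i j
  shift-suc i zero = refl
  shift-suc i (suc j) = refl

binomTerm : ℕ → ℕ → ℕ → ℕ → ℕ
binomTerm a b i j = binom i j * (a ^ i * b ^ j)

binomTerm-pascal : ∀ a b i j → (i + j ≢ 0) →
  binomTerm a b i j ≡ shiftˡ (λ i j → a * binomTerm a b i j) i j + shiftʳ (λ i j → b * binomTerm a b i j) i j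
binomTerm-pascal a b zero zero 0≢0 = ⊥-elim (0≢0 refl)
binomTerm-pascal a b zero (suc j) _ = left-edge b (b ^ j)
  where
  left-edge : ∀ b z → 1 * (1 * (b * z)) ≡ b * (1 * (1 * z))
  left-edge = solve-∀
binomTerm-pascal a b (suc i) zero _ = trans (right-edge a (a ^ i)) (cong (λ w → a * (w * (a ^ i * 1)) + 0) (binom-0 i))
  where
  right-edge : ∀ a z → 1 * (a * z * 1) ≡ a * (1 * (z * 1)) + 0
  right-edge = solve-∀
  binom-0 : ∀ i → 1 ≡ binom i 0
  binom-0 zero = refl
  binom-0 (suc i) = refl
binomTerm-pascal a b (suc i) (suc j) _ = inner (binom i (suc j)) (binom (suc i) j) a b (a ^ i) (b ^ j)
  where
  inner : ∀ A C a b x y → (A + C) * (a * x * (b * y)) ≡ a * (A * (x * (b * y))) + b * (C * (a * x * y))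
  inner = solve-∀

binomial-theorem : ∀ a b n → (a + b) ^ n ≡ diagSum (binomTerm a b) n
binomial-theorem a b zero = refl
binomial-theorem a b (suc n) = begin
  (a + b) * (a + b) ^ n
    ≡⟨ cong ((a + b) *_) (binomial-theorem a b n) ⟩
  (a + b) * S
    ≡⟨ *-distribʳ-+ S a b ⟩
  a * S + b * S
    ≡⟨ cong₂ _+_ (diagSum-* a (binomTerm a b) n) (trans (diagSum-* b (binomTerm a b) n) (sym (diagSum-shiftʳ V n))) ⟩
  diagSum (shiftˡ U) (suc n) + diagSum (shiftʳ V) (suc n)
    ≡⟨ diagSum-+ (shiftˡ U) (shiftʳ V) (suc n) ⟨
  diagSum (λ i j → shiftˡ U i j + shiftʳ V i j) (suc n)
    ≡⟨ cong₂ _+_ (sym (binomTerm-pascal a b 0 (suc n) (λ ()))) (diagSum-cong _ _ n (λ i j → sym (binomTerm-pascal a b (suc i) j (λ ())))) ⟩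
  diagSum (binomTerm a b) (suc n) ∎
  where
  open ≡-Reasoning
  S = diagSum (binomTerm a b) n
  U = λ i j → a * binomTerm a b i j
  V = λ i j → b * binomTerm a b i j

diagSum-term : ∀ f i j → f i j ≤ diagSum f (i + j)
diagSum-term f zero zero = ≤-refl
diagSum-term f zero (suc j) = m≤m+n _ _
diagSum-term f (suc i) j = ≤-trans (diagSum-term (λ i j → f (suc i) j) i j) (m≤n+m _ _)

diagSum-bound : ∀ f n M → (∀ i j → i + j ≡ n → f i j ≤ M) → diagSum f n ≤ suc n * M
diagSum-bound f zero M h = ≤-trans (h 0 0 refl) (≤-reflexive (sym (+-identityʳ M)))
diagSum-bound f (suc n) M h = +-mono-≤ (h 0 (suc n) refl) (diagSum-bound (λ i j → f (suc i) j) n M (λ i j e → h (suc i) j (cong suc e)))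

binom-ratio : ∀ i j → binom (suc i) j * suc i ≡ binom i (suc j) * suc j
binom-ratio i j = *-cancelʳ-≡ _ _ (i ! * j !) {{m*n≢0 (i !) (j !) {{i !≢0}} {{j !≢0}}}} (begin
  binom (suc i) j * suc i * (i ! * j !)   ≡⟨ reassoc (binom (suc i) j) (suc i) (i !) (j !) ⟩
  binom (suc i) j * (suc i ! * j !)       ≡⟨ binom-factorial (suc i) j ⟩
  (suc i + j) !                           ≡⟨ cong _! (+-suc i j) ⟨
  (i + suc j) !                           ≡⟨ binom-factorial i (suc j) ⟨
  binom i (suc j) * (i ! * suc j !)       ≡⟨ reassoc′ (binom i (suc j)) (suc j) (i !) (j !) ⟩
  binom i (suc j) * suc j * (i ! * j !)   ∎)
  where
  open ≡-Reasoning
  reassoc : ∀ B s x y → B * s * (x * y) ≡ B * (s * x * y)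
  reassoc = solve-∀
  reassoc′ : ∀ B s x y → B * (x * (s * y)) ≡ B * s * (x * y)
  reassoc′ = solve-∀

binomTerm-ratio : ∀ k l i j → binomTerm k l (suc i) j * (suc i * l) ≡ binomTerm k l i (suc j) * (suc j * k)
binomTerm-ratio k l i j = begin
  binom (suc i) j * (k * k ^ i * l ^ j) * (suc i * l) ≡⟨ gather (binom (suc i) j) (suc i) k (k ^ i) (l ^ j) l ⟩
  binom (suc i) j * suc i * W                         ≡⟨ cong (_* W) (binom-ratio i j) ⟩
  binom i (suc j) * suc j * W                         ≡⟨ scatter (binom i (suc j)) (suc j) k (k ^ i) (l ^ j) l ⟩
  binom i (suc j) * (k ^ i * (l * l ^ j)) * (suc j * k) ∎
  where
  open ≡-Reasoning
  W = k * k ^ i * l ^ j * l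
  gather : ∀ B s k x y l → B * (k * x * y) * (s * l) ≡ B * s * (k * x * y * l)
  gather = solve-∀
  scatter : ∀ B s k x y l → B * s * (k * x * y * l) ≡ B * (x * (l * y)) * (s * k)
  scatter = solve-∀

binomTerm-rises : ∀ k l i j → 1 ≤ l → suc i ≤ k → l ≤ suc j → binomTerm k l i (suc j) ≤ binomTerm k l (suc i) j
binomTerm-rises k l i j l≥1 i<k l≤sj = *-cancelʳ-≤ _ _ (suc i * l) {{m*n≢0 (suc i) l {{_}} {{>-nonZero l≥1}}}} (begin
  binomTerm k l i (suc j) * (suc i * l) ≤⟨ *-monoʳ-≤ (binomTerm k l i (suc j)) (≤-trans (*-mono-≤ i<k l≤sj) (≤-reflexive (*-comm k (suc j)))) ⟩
  binomTerm k l i (suc j) * (suc j * k) ≡⟨ binomTerm-ratio k l i j ⟨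
  binomTerm k l (suc i) j * (suc i * l) ∎)
  where open ≤-Reasoning

binomTerm-falls : ∀ k l i j → 1 ≤ l → k ≤ suc i → suc j ≤ l → binomTerm k l (suc i) j ≤ binomTerm k l i (suc j)
binomTerm-falls k l i j l≥1 k≤si j<l = *-cancelʳ-≤ _ _ (suc i * l) {{m*n≢0 (suc i) l {{_}} {{>-nonZero l≥1}}}} (begin
  binomTerm k l (suc i) j * (suc i * l) ≡⟨ binomTerm-ratio k l i j ⟩
  binomTerm k l i (suc j) * (suc j * k) ≤⟨ *-monoʳ-≤ (binomTerm k l i (suc j)) (≤-trans (*-mono-≤ j<l k≤si) (≤-reflexive (*-comm l (suc i)))) ⟩
  binomTerm k l i (suc j) * (suc i * l) ∎)
  where open ≤-Reasoning

binomTerm-before-max : ∀ k l d i → 1 ≤ l → i + d ≡ k → binomTerm k l i (l + d) ≤ binomTerm k l k l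
binomTerm-before-max k l zero i l≥1 i+0≡k rewrite +-identityʳ i | +-identityʳ l | i+0≡k = ≤-refl
binomTerm-before-max k l (suc d) i l≥1 i+sd≡k = begin
  binomTerm k l i (l + suc d)    ≡⟨ cong (binomTerm k l i) (+-suc l d) ⟩
  binomTerm k l i (suc (l + d))  ≤⟨ binomTerm-rises k l i (l + d) l≥1 i<k (≤-trans (m≤m+n l d) (n≤1+n _)) ⟩
  binomTerm k l (suc i) (l + d)  ≤⟨ binomTerm-before-max k l d (suc i) l≥1 (trans (sym (+-suc i d)) i+sd≡k) ⟩
  binomTerm k l k l              ∎
  where
  open ≤-Reasoning
  i<k : suc i ≤ k
  i<k = subst (suc i ≤_) i+sd≡k (subst (suc i ≤_) (sym (+-suc i d)) (s≤s (m≤m+n i d)))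

binomTerm-after-max : ∀ k l d j → 1 ≤ l → j + d ≡ l → binomTerm k l (k + d) j ≤ binomTerm k l k l
binomTerm-after-max k l zero j l≥1 j+0≡l rewrite +-identityʳ k | +-identityʳ j | j+0≡l = ≤-refl
binomTerm-after-max k l (suc d) j l≥1 j+sd≡l = begin
  binomTerm k l (k + suc d) j    ≡⟨ cong (λ z → binomTerm k l z j) (+-suc k d) ⟩
  binomTerm k l (suc (k + d)) j  ≤⟨ binomTerm-falls k l (k + d) j l≥1 (≤-trans (m≤m+n k d) (n≤1+n _)) j<l ⟩
  binomTerm k l (k + d) (suc j)  ≤⟨ binomTerm-after-max k l d (suc j) l≥1 (trans (sym (+-suc j d)) j+sd≡l) ⟩
  binomTerm k l k l              ∎
  where
  open ≤-Reasoning
  j<l : suc j ≤ l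
  j<l = subst (suc j ≤_) j+sd≡l (subst (suc j ≤_) (sym (+-suc j d)) (s≤s (m≤m+n j d)))

binomTerm-max : ∀ k l i j → 1 ≤ l → i + j ≡ k + l → binomTerm k l i j ≤ binomTerm k l k l
binomTerm-max k l i j l≥1 i+j≡k+l with i ≤? k
... | yes i≤k = subst (λ z → binomTerm k l i z ≤ binomTerm k l k l) l+d≡j (binomTerm-before-max k l (k ∸ i) i l≥1 (m+[n∸m]≡n i≤k))
  where
  l+d≡j : l + (k ∸ i) ≡ j
  l+d≡j = +-cancelˡ-≡ i _ _ (begin
    i + (l + (k ∸ i)) ≡⟨ swap i l (k ∸ i) ⟩
    i + (k ∸ i) + l   ≡⟨ cong (_+ l) (m+[n∸m]≡n i≤k) ⟩
    k + l             ≡⟨ i+j≡k+l ⟨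
    i + j             ∎)
    where
    open ≡-Reasoning
    swap : ∀ i l d → i + (l + d) ≡ i + d + l
    swap = solve-∀
... | no i≰k = subst (λ z → binomTerm k l z j ≤ binomTerm k l k l) k+d≡i (binomTerm-after-max k l (i ∸ k) j l≥1 j+d≡l)
  where
  k+d≡i : k + (i ∸ k) ≡ i
  k+d≡i = m+[n∸m]≡n (<⇒≤ (≰⇒> i≰k))
  j+d≡l : j + (i ∸ k) ≡ l
  j+d≡l = +-cancelˡ-≡ k _ _ (begin
    k + (j + (i ∸ k)) ≡⟨ swap k j (i ∸ k) ⟩
    k + (i ∸ k) + j   ≡⟨ cong (_+ j) k+d≡i ⟩
    i + j             ≡⟨ i+j≡k+l ⟩
    k + l             ∎)
    where
    open ≡-Reasoning
    swap : ∀ k j d → k + (j + d) ≡ k + d + j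
    swap = solve-∀

binom-upper : ∀ k l → binom k l * (k ^ k * l ^ l) ≤ (k + l) ^ (k + l)
binom-upper k l = ≤-trans (diagSum-term (binomTerm k l) k l) (≤-reflexive (sym (binomial-theorem k l (k + l))))

binom-lower : ∀ k l → 1 ≤ l → (k + l) ^ (k + l) ≤ suc (k + l) * (binom k l * (k ^ k * l ^ l))
binom-lower k l l≥1 = ≤-trans (≤-reflexive (binomial-theorem k l (k + l)))
                              (diagSum-bound (binomTerm k l) (k + l) _ (λ i j e → binomTerm-max k l i j l≥1 e))

module _ (α β m : ℕ) .{{_ : NonZero m}} where
  private
    k = α * m
    l = β * m

  powers-scale : α ^ k * m ^ k * (β ^ l * m ^ l) ≡ k ^ k * l ^ l
  powers-scale = sym (cong₂ _*_ (^-distribʳ-* α m k) (^-distribʳ-* β m l))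

  sum-scale : (α + β) ^ (k + l) * (m ^ k * m ^ l) ≡ (k + l) ^ (k + l)
  sum-scale = begin
    (α + β) ^ (k + l) * (m ^ k * m ^ l) ≡⟨ cong ((α + β) ^ (k + l) *_) (^-distribˡ-+-* m k l) ⟨
    (α + β) ^ (k + l) * m ^ (k + l)     ≡⟨ ^-distribʳ-* (α + β) m (k + l) ⟨
    ((α + β) * m) ^ (k + l)             ≡⟨ cong (_^ (k + l)) (*-distribʳ-+ m α β) ⟩
    (k + l) ^ (k + l)                   ∎
    where open ≡-Reasoning

  m-powers≢0 : NonZero (m ^ k * m ^ l)
  m-powers≢0 = m*n≢0 (m ^ k) (m ^ l) {{m^n≢0 m k}} {{m^n≢0 m l}}

  binom-upper-scaled : binom k l * (α ^ k * β ^ l) ≤ (α + β) ^ (k + l)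
  binom-upper-scaled = *-cancelʳ-≤ _ _ (m ^ k * m ^ l) {{m-powers≢0}} (begin
    binom k l * (α ^ k * β ^ l) * (m ^ k * m ^ l)   ≡⟨ interchange (binom k l) (α ^ k) (β ^ l) (m ^ k) (m ^ l) ⟩
    binom k l * (α ^ k * m ^ k * (β ^ l * m ^ l))   ≡⟨ cong (binom k l *_) powers-scale ⟩
    binom k l * (k ^ k * l ^ l)                     ≤⟨ binom-upper k l ⟩
    (k + l) ^ (k + l)                               ≡⟨ sum-scale ⟨
    (α + β) ^ (k + l) * (m ^ k * m ^ l)             ∎)
    where
    open ≤-Reasoning
    interchange : ∀ B a b x y → B * (a * b) * (x * y) ≡ B * (a * x * (b * y))
    interchange = solve-∀

  binom-lower-scaled : 1 ≤ β → (α + β) ^ (k + l) ≤ suc (k + l) * (binom k l * (α ^ k * β ^ l))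
  binom-lower-scaled β≥1 = *-cancelʳ-≤ _ _ (m ^ k * m ^ l) {{m-powers≢0}} (begin
    (α + β) ^ (k + l) * (m ^ k * m ^ l)                       ≡⟨ sum-scale ⟩
    (k + l) ^ (k + l)                                         ≤⟨ binom-lower k l (*-mono-≤ β≥1 (>-nonZero⁻¹ m)) ⟩
    suc (k + l) * (binom k l * (k ^ k * l ^ l))               ≡⟨ cong (λ z → suc (k + l) * (binom k l * z)) powers-scale ⟨
    suc (k + l) * (binom k l * (α ^ k * m ^ k * (β ^ l * m ^ l)))
      ≡⟨ interchange (suc (k + l)) (binom k l) (α ^ k) (β ^ l) (m ^ k) (m ^ l) ⟩
    suc (k + l) * (binom k l * (α ^ k * β ^ l)) * (m ^ k * m ^ l) ∎)
    where
    open ≤-Reasoning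
    interchange : ∀ s B a b x y → s * (B * (a * x * (b * y))) ≡ s * (B * (a * b)) * (x * y)
    interchange = solve-∀

-- Ψ x = Π_p p^#{k : p^k ≤ x} = lcm(1, …, x), and the Chebyshev quotient
-- Γ x = Π_p p^(Σ_k chebyshev ⌊x/p^k⌋); N is a cut-off for primes and powers.
Ψ : ℕ → ℕ → ℕ
Ψ x N = primeProduct (λ q → adicSum positive q x N) N

Γ : ℕ → ℕ → ℕ
Γ x N = primeProduct (λ q → adicSum chebyshev q x N) N

Ψ-mono : ∀ {x x'} N → x ≤ x' → Ψ x N ≤ Ψ x' N
Ψ-mono N x≤x' = primeProduct-mono _ _ N (λ q _ → adicSum-monoᵐ positive q _ _ N positive-mono x≤x')

Γ≤Ψ : ∀ x N → Γ x N ≤ Ψ x N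
Γ≤Ψ x N = primeProduct-mono _ _ N (λ q _ → adicSum-mono chebyshev positive q x N chebyshev≤positive)
  where
  chebyshev≤positive : ∀ y → chebyshev y ≤ positive y
  chebyshev≤positive zero = z≤n
  chebyshev≤positive (suc y) = chebyshev≤1 (suc y)

Ψ-zero : ∀ N → Ψ 0 N ≡ 1
Ψ-zero N = primeProduct-trivial _ N (λ q _ _ _ → adicSum-zero positive q N refl)

primePower-Ψ : ∀ q' x B → 1 ≤ x → (2 + q') ^ (adicSum positive (2 + q') x B) ≤ x
primePower-Ψ q' x zero x≥1 = x≥1
primePower-Ψ q' x (suc B) x≥1 with x / (2 + q') in x/q≡
... | zero rewrite adicSum-zero positive (2 + q') B refl = x≥1
... | suc y = begin
  (2 + q') * (2 + q') ^ adicSum positive (2 + q') (suc y) B ≤⟨ *-monoʳ-≤ (2 + q') (primePower-Ψ q' (suc y) B (s≤s z≤n)) ⟩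
  (2 + q') * suc y                                          ≡⟨ *-comm (2 + q') (suc y) ⟩
  suc y * (2 + q')                                          ≡⟨ cong (_* (2 + q')) x/q≡ ⟨
  x / (2 + q') * (2 + q')                                   ≤⟨ m/n*n≤m x (2 + q') ⟩
  x                                                         ∎
  where open ≤-Reasoning

Ψ≤x^x : ∀ x N → 1 ≤ x → x ≤ N → Ψ x N ≤ x ^ x
Ψ≤x^x x N x≥1 x≤N = begin
  Ψ x N                                                   ≡⟨ cong (primeProduct (λ q → adicSum positive q x N)) (m∸n+n≡m x≤N) ⟨
  primeProduct (λ q → adicSum positive q x N) ((N ∸ x) + x) ≡⟨ primeProduct-extend _ x (N ∸ x) (λ q x<q _ → adicSum-small positive q x N refl x<q) ⟩
  primeProduct (λ q → adicSum positive q x N) x           ≤⟨ primeProduct-bound _ x x x≥1 bound ⟩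
  x ^ x                                                   ∎
  where
  open ≤-Reasoning
  bound : ∀ q → q ≤ x → Prime q → q ^ adicSum positive q x N ≤ x
  bound q _ pq with prime⇒2+ pq
  ... | q' , refl = primePower-Ψ q' x N x≥1

legendre-part : ∀ m N c d .{{_ : NonZero d}} → c * d ≡ 30 → 30 * m ≤ N →
  (c * m) ! ≡ primeProduct (λ q → adicSum (λ y → y / d) q (30 * m) N) N
legendre-part m N c d cd≡30 30m≤N = begin
  (c * m) !                                                    ≡⟨ legendre (c * m) N (≤-trans cm≤30m 30m≤N) ⟩
  primeProduct (λ q → adicSum id q (c * m) N) N                ≡⟨ primeProduct-cong _ _ N (λ q _ → divide q) ⟩
  primeProduct (λ q → adicSum (λ y → y / d) q (30 * m) N) N    ∎
  where
  open ≡-Reasoning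
  30m≡cmd : 30 * m ≡ c * m * d
  30m≡cmd = trans (cong (_* m) (sym cd≡30)) (swap c d m)
    where
    swap : ∀ c d m → c * d * m ≡ c * m * d
    swap = solve-∀
  cm≤30m : c * m ≤ 30 * m
  cm≤30m = subst (c * m ≤_) (cong (_* m) cd≡30) (*-monoˡ-≤ m (m≤m*n c d))
  divide : ∀ q → adicSum id q (c * m) N ≡ adicSum (λ y → y / d) q (30 * m) N
  divide q = begin
    adicSum id q (c * m) N            ≡⟨ cong (λ z → adicSum id q z N) (trans (/-congˡ 30m≡cmd) (m*n/n≡m (c * m) d)) ⟨
    adicSum id q (30 * m / d) N       ≡⟨ adicSum-/ id q (30 * m) N d ⟩
    adicSum (λ y → y / d) q (30 * m) N ∎

-- The exponent identity chebyshev y + ⌊y/2⌋ + ⌊y/3⌋ + ⌊y/5⌋ = y + ⌊y/30⌋ gives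
--   Γ(30m) · (15m)! (10m)! (6m)! = (30m)! m!.
Γ-factorials : ∀ m N → 30 * m ≤ N → Γ (30 * m) N * ((15 * m) ! * (10 * m) ! * (6 * m) !) ≡ (30 * m) ! * m !
Γ-factorials m N 30m≤N = begin
  Γ x N * ((15 * m) ! * (10 * m) ! * (6 * m) !)
    ≡⟨ cong (Γ x N *_) (cong₂ _*_ (cong₂ _*_ (part 15 2 refl) (part 10 3 refl)) (part 6 5 refl)) ⟩
  Γ x N * (primeProduct (by 2) N * primeProduct (by 3) N * primeProduct (by 5) N)
    ≡⟨ cong (Γ x N *_) (trans (primeProduct-+ _ _ N) (cong (_* primeProduct (by 5) N) (primeProduct-+ (by 2) (by 3) N))) ⟨
  Γ x N * primeProduct (λ q → by 2 q + by 3 q + by 5 q) N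
    ≡⟨ primeProduct-+ _ _ N ⟨
  primeProduct (λ q → adicSum chebyshev q x N + (by 2 q + by 3 q + by 5 q)) N
    ≡⟨ primeProduct-cong _ _ N (λ q _ → exponents q) ⟩
  primeProduct (λ q → adicSum id q x N + by 30 q) N
    ≡⟨ primeProduct-+ _ _ N ⟩
  primeProduct (λ q → adicSum id q x N) N * primeProduct (by 30) N
    ≡⟨ cong₂ _*_ (legendre x N 30m≤N) (trans (cong _! (sym (*-identityˡ m))) (part 1 30 refl)) ⟨
  x ! * m ! ∎
  where
  open ≡-Reasoning
  x = 30 * m
  by : (d : ℕ) .{{_ : NonZero d}} → ℕ → ℕ
  by d q = adicSum (λ y → y / d) q x N
  part : ∀ c d .{{_ : NonZero d}} → c * d ≡ 30 → (c * m) ! ≡ primeProduct (by d) N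
  part c d cd≡30 = legendre-part m N c d cd≡30 30m≤N
  exponents : ∀ q → adicSum chebyshev q x N + (by 2 q + by 3 q + by 5 q) ≡ adicSum id q x N + by 30 q
  exponents q = begin
    adicSum chebyshev q x N + (by 2 q + by 3 q + by 5 q)
      ≡⟨ cong (adicSum chebyshev q x N +_) (trans (adicSum-+ _ _ q x N) (cong (_+ by 5 q) (adicSum-+ _ _ q x N))) ⟨
    adicSum chebyshev q x N + adicSum divSum q x N
      ≡⟨ adicSum-+ _ _ q x N ⟨
    adicSum (λ y → chebyshev y + divSum y) q x N
      ≡⟨ adicSum-cong _ _ q x N chebyshev-identity ⟩
    adicSum (λ y → y + y / 30) q x N
      ≡⟨ adicSum-+ _ _ q x N ⟩
    adicSum id q x N + by 30 q ∎

Γ-binoms : ∀ m N → 30 * m ≤ N → Γ (30 * m) N * binom m (5 * m) ≡ binom (15 * m) (15 * m) * binom (5 * m) (10 * m)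
Γ-binoms m N 30m≤N = *-cancelʳ-≡ _ _ (a * b * c * d) {{all≢0}} (begin
  g * B₁ * (a * b * c * d)     ≡⟨ regroup g B₁ a b c d ⟩
  g * (a * b * (B₁ * (d * c))) ≡⟨ cong (λ z → g * (a * b * z)) (binom-sum m (5 * m) (6 * m) (1+5 m)) ⟩
  g * (a * b * (6 * m) !)      ≡⟨ Γ-factorials m N 30m≤N ⟩
  (30 * m) ! * d               ≡⟨ cong (_* d) (binom-sum (15 * m) (15 * m) (30 * m) (15+15 m)) ⟨
  B₁₅ * (a * a) * d            ≡⟨ cong (λ z → B₁₅ * (z * a) * d) (binom-sum (5 * m) (10 * m) (15 * m) (5+10 m)) ⟨
  B₁₅ * (B₅ * (c * b) * a) * d ≡⟨ regroup′ B₁₅ B₅ a b c d ⟩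
  B₁₅ * B₅ * (a * b * c * d)   ∎)
  where
  open ≡-Reasoning
  g = Γ (30 * m) N
  B₁ = binom m (5 * m)
  B₁₅ = binom (15 * m) (15 * m)
  B₅ = binom (5 * m) (10 * m)
  a = (15 * m) !
  b = (10 * m) !
  c = (5 * m) !
  d = m !
  all≢0 : NonZero (a * b * c * d)
  all≢0 = m*n≢0 _ _ {{m*n≢0 _ _ {{m*n≢0 _ _ {{(15 * m) !≢0}} {{(10 * m) !≢0}}}} {{(5 * m) !≢0}}}} {{m !≢0}}
  binom-sum : ∀ i j s → i + j ≡ s → binom i j * (i ! * j !) ≡ s !
  binom-sum i j s i+j≡s = trans (binom-factorial i j) (cong _! i+j≡s)
  1+5 : ∀ m → m + 5 * m ≡ 6 * m
  1+5 = solve-∀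
  5+10 : ∀ m → 5 * m + 10 * m ≡ 15 * m
  5+10 = solve-∀
  15+15 : ∀ m → 15 * m + 15 * m ≡ 30 * m
  15+15 = solve-∀
  regroup : ∀ g B a b c d → g * B * (a * b * c * d) ≡ g * (a * b * (B * (d * c)))
  regroup = solve-∀
  regroup′ : ∀ B₁₅ B₅ a b c d → B₁₅ * (B₅ * (c * b) * a) * d ≡ B₁₅ * B₅ * (a * b * c * d)
  regroup′ = solve-∀

module _ (α β b : ℕ) .{{_ : NonZero b}} where
  private
    split : (α + β) * b ≡ α * b + β * b
    split = *-distribʳ-+ b α β

  binom-upper-at : binom (α * b) (β * b) * (α ^ (α * b) * β ^ (β * b)) ≤ (α + β) ^ ((α + β) * b)
  binom-upper-at = subst (λ e → binom (α * b) (β * b) * (α ^ (α * b) * β ^ (β * b)) ≤ (α + β) ^ e) (sym split) (binom-upper-scaled α β b)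

  binom-lower-at : 1 ≤ β → (α + β) ^ ((α + β) * b) ≤ suc ((α + β) * b) * (binom (α * b) (β * b) * (α ^ (α * b) * β ^ (β * b)))
  binom-lower-at β≥1 = subst (λ e → (α + β) ^ e ≤ suc e * (binom (α * b) (β * b) * (α ^ (α * b) * β ^ (β * b))))
                              (sym split) (binom-lower-scaled α β b β≥1)

binom-1-5 : ∀ b → binom (1 * b) (5 * b) * (1 ^ (1 * b) * 5 ^ (5 * b)) ≡ binom b (5 * b) * 5 ^ (5 * b)
binom-1-5 b = begin
  binom (1 * b) (5 * b) * (1 ^ (1 * b) * p) ≡⟨ cong₂ (λ u v → binom u (5 * b) * (v * p)) (*-identityˡ b) (^-zeroˡ (1 * b)) ⟩
  binom b (5 * b) * (1 * p)                 ≡⟨ cong (binom b (5 * b) *_) (*-identityˡ p) ⟩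
  binom b (5 * b) * p                       ∎
  where
  open ≡-Reasoning
  p = 5 ^ (5 * b)

-- Γ(30b) grows like (Num / Den)^b:  Num = 30^30 15^15,  Den = 6^6 10^10 15^30.
opaque
  Num : ℕ
  Num = 30 ^ 30 * 15 ^ 15

  Den : ℕ
  Den = 6 ^ 6 * 10 ^ 10 * 15 ^ 30

opaque
  unfolding Num Den

  Num^ : ∀ b → Num ^ b ≡ 30 ^ (30 * b) * 15 ^ (15 * b)
  Num^ b = trans (^-distribʳ-* (30 ^ 30) (15 ^ 15) b) (cong₂ _*_ (^-*-assoc 30 30 b) (^-*-assoc 15 15 b))

  Den^ : ∀ b → Den ^ b ≡ 6 ^ (6 * b) * 10 ^ (10 * b) * (15 ^ (15 * b) * 15 ^ (15 * b))
  Den^ b = begin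
    Den ^ b                                              ≡⟨ ^-distribʳ-* (6 ^ 6 * 10 ^ 10) (15 ^ 30) b ⟩
    (6 ^ 6 * 10 ^ 10) ^ b * (15 ^ 30) ^ b                ≡⟨ cong (_* (15 ^ 30) ^ b) (^-distribʳ-* (6 ^ 6) (10 ^ 10) b) ⟩
    (6 ^ 6) ^ b * (10 ^ 10) ^ b * (15 ^ 30) ^ b          ≡⟨ cong₂ _*_ (cong₂ _*_ (^-*-assoc 6 6 b) (^-*-assoc 10 10 b)) (^-*-assoc 15 30 b) ⟩
    6 ^ (6 * b) * 10 ^ (10 * b) * 15 ^ (30 * b)          ≡⟨ cong (λ e → 6 ^ (6 * b) * 10 ^ (10 * b) * 15 ^ e) (*-distribʳ-+ b 15 15) ⟩
    6 ^ (6 * b) * 10 ^ (10 * b) * 15 ^ (15 * b + 15 * b) ≡⟨ cong (6 ^ (6 * b) * 10 ^ (10 * b) *_) (^-distribˡ-+-* 15 (15 * b) (15 * b)) ⟩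
    6 ^ (6 * b) * 10 ^ (10 * b) * (15 ^ (15 * b) * 15 ^ (15 * b)) ∎
    where open ≡-Reasoning

  Num≢0 : NonZero Num
  Num≢0 = _

  Den≢0 : NonZero Den
  Den≢0 = _

Γ-upper : ∀ b N → 1 ≤ b → 30 * b ≤ N → Γ (30 * b) N * Den ^ b ≤ Num ^ b * suc (6 * b)
Γ-upper b N b≥1 30b≤N = begin
  g * Den ^ b                                ≡⟨ cong (g *_) (Den^ b) ⟩
  g * (p6 * p10 * (q * q))                   ≤⟨ *-monoʳ-≤ g (*-monoˡ-≤ (q * q) (*-monoˡ-≤ p10 six)) ⟩
  g * (s * (C * p5) * p10 * (q * q))         ≡⟨ regroup g s C p5 p10 q ⟩
  s * (g * C) * (p5 * p10) * (q * q)         ≡⟨ cong (λ z → s * z * (p5 * p10) * (q * q)) (Γ-binoms b N 30b≤N) ⟩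
  s * (A * B) * (p5 * p10) * (q * q)         ≡⟨ regroup′ s A B p5 p10 q ⟩
  s * (A * (q * q)) * (B * (p5 * p10))       ≤⟨ *-mono-≤ (*-monoʳ-≤ s (binom-upper-at 15 15 b)) (binom-upper-at 5 10 b) ⟩
  s * 30 ^ (30 * b) * 15 ^ (15 * b)          ≡⟨ rotate s (30 ^ (30 * b)) (15 ^ (15 * b)) ⟩
  30 ^ (30 * b) * 15 ^ (15 * b) * s          ≡⟨ cong (_* s) (Num^ b) ⟨
  Num ^ b * s                                ∎
  where
  open ≤-Reasoning
  instance _ = >-nonZero b≥1
  g = Γ (30 * b) N
  s = suc (6 * b)
  C = binom b (5 * b)
  A = binom (15 * b) (15 * b)
  B = binom (5 * b) (10 * b)
  p5 = 5 ^ (5 * b)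
  p6 = 6 ^ (6 * b)
  p10 = 10 ^ (10 * b)
  q = 15 ^ (15 * b)
  six : p6 ≤ s * (C * p5)
  six = subst (p6 ≤_) (cong (s *_) (binom-1-5 b)) (binom-lower-at 1 5 b (s≤s z≤n))
  regroup : ∀ g s C p5 p10 q → g * (s * (C * p5) * p10 * (q * q)) ≡ s * (g * C) * (p5 * p10) * (q * q)
  regroup = solve-∀
  regroup′ : ∀ s A B p5 p10 q → s * (A * B) * (p5 * p10) * (q * q) ≡ s * (A * (q * q)) * (B * (p5 * p10))
  regroup′ = solve-∀
  rotate : ∀ s x y → s * x * y ≡ x * y * s
  rotate = solve-∀

Γ-lower : ∀ a N → 1 ≤ a → 30 * a ≤ N → Num ^ a ≤ suc (30 * a) * suc (15 * a) * (Γ (30 * a) N * Den ^ a)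
Γ-lower a N a≥1 30a≤N = begin
  Num ^ a                                          ≡⟨ Num^ a ⟩
  30 ^ (30 * a) * q                                ≤⟨ *-mono-≤ (binom-lower-at 15 15 a (s≤s z≤n)) (binom-lower-at 5 10 a (s≤s z≤n)) ⟩
  s₁ * (A * (q * q)) * (s₂ * (B * (p5 * p10)))     ≡⟨ regroup s₁ s₂ A B p5 p10 q ⟩
  s₁ * s₂ * (A * B * p5 * p10 * (q * q))           ≡⟨ cong (λ z → s₁ * s₂ * (z * p5 * p10 * (q * q))) (Γ-binoms a N 30a≤N) ⟨
  s₁ * s₂ * (g * C * p5 * p10 * (q * q))           ≡⟨ cong (s₁ * s₂ *_) (regroup′ g C p5 p10 q) ⟩
  s₁ * s₂ * (g * (C * p5 * p10 * (q * q)))         ≤⟨ *-monoʳ-≤ (s₁ * s₂) (*-monoʳ-≤ g (*-monoˡ-≤ (q * q) (*-monoˡ-≤ p10 six))) ⟩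
  s₁ * s₂ * (g * (p6 * p10 * (q * q)))             ≡⟨ cong (λ z → s₁ * s₂ * (g * z)) (Den^ a) ⟨
  s₁ * s₂ * (g * Den ^ a)                          ∎
  where
  open ≤-Reasoning
  instance _ = >-nonZero a≥1
  g = Γ (30 * a) N
  s₁ = suc (30 * a)
  s₂ = suc (15 * a)
  C = binom a (5 * a)
  A = binom (15 * a) (15 * a)
  B = binom (5 * a) (10 * a)
  p5 = 5 ^ (5 * a)
  p6 = 6 ^ (6 * a)
  p10 = 10 ^ (10 * a)
  q = 15 ^ (15 * a)
  six : C * p5 ≤ p6
  six = subst (_≤ p6) (binom-1-5 a) (binom-upper-at 1 5 a)
  regroup : ∀ s₁ s₂ A B p5 p10 q → s₁ * (A * (q * q)) * (s₂ * (B * (p5 * p10))) ≡ s₁ * s₂ * (A * B * p5 * p10 * (q * q))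
  regroup = solve-∀
  regroup′ : ∀ g C p5 p10 q → g * C * p5 * p10 * (q * q) ≡ g * (C * p5 * p10 * (q * q))
  regroup′ = solve-∀

-- Since chebyshev y = 1 for 1 ≤ y ≤ 5:  [y ≥ 1] ≤ chebyshev y + [⌊y/6⌋ ≥ 1],
-- hence Ψ(30c) ≤ Γ(30c) · Ψ(5c).
positive≤chebyshev+ : ∀ y → positive y ≤ chebyshev y + positive (y / 6)
positive≤chebyshev+ zero = z≤n
positive≤chebyshev+ (suc y) with suc y ≤? 5
... | yes sy≤5 = ≤-trans (≤-reflexive (sym (chebyshev-small (suc y) (s≤s z≤n) sy≤5))) (m≤m+n (chebyshev (suc y)) _)
... | no sy≰5 = ≤-trans (≤-reflexive (sym (positive-≥1 (m≥n⇒m/n>0 (≰⇒> sy≰5))))) (m≤n+m _ (chebyshev (suc y)))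
  where
  positive-≥1 : ∀ {z} → 1 ≤ z → positive z ≡ 1
  positive-≥1 {suc _} _ = refl

Ψ-recursion : ∀ c N → Ψ (30 * c) N ≤ Γ (30 * c) N * Ψ (5 * c) N
Ψ-recursion c N = begin
  Ψ (30 * c) N                                                        ≤⟨ primeProduct-mono _ _ N (λ q _ → exponents q) ⟩
  primeProduct (λ q → adicSum chebyshev q (30 * c) N + adicSum positive q (5 * c) N) N ≡⟨ primeProduct-+ _ _ N ⟩
  Γ (30 * c) N * Ψ (5 * c) N                                          ∎
  where
  open ≤-Reasoning
  30c/6≡5c : 30 * c / 6 ≡ 5 * c
  30c/6≡5c = trans (/-congˡ (factor c)) (m*n/n≡m (5 * c) 6)
    where
    factor : ∀ c → 30 * c ≡ 5 * c * 6
    factor = solve-∀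
  exponents : ∀ q → adicSum positive q (30 * c) N ≤ adicSum chebyshev q (30 * c) N + adicSum positive q (5 * c) N
  exponents q = begin
    adicSum positive q (30 * c) N                                      ≤⟨ adicSum-mono _ _ q (30 * c) N positive≤chebyshev+ ⟩
    adicSum (λ y → chebyshev y + positive (y / 6)) q (30 * c) N        ≡⟨ adicSum-+ _ _ q (30 * c) N ⟩
    adicSum chebyshev q (30 * c) N + adicSum (λ y → positive (y / 6)) q (30 * c) N
      ≡⟨ cong (adicSum chebyshev q (30 * c) N +_) (adicSum-/ positive q (30 * c) N 6) ⟨
    adicSum chebyshev q (30 * c) N + adicSum positive q (30 * c / 6) N ≡⟨ cong (λ z → adicSum chebyshev q (30 * c) N + adicSum positive q z N) 30c/6≡5c ⟩
    adicSum chebyshev q (30 * c) N + adicSum positive q (5 * c) N      ∎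

-- Ratio test for the exponential comparison behind Chebyshev's bound:
-- if 2 X b^5 ≤ b^30 Y, the inequality X^c (6c+1) b^(5c+25) ≤ b^(30c) Y^c
-- propagates from c to c + 1.
growth-step : ∀ X Y b → 2 * X * b ^ 5 ≤ b ^ 30 * Y → ∀ c → 1 ≤ c →
  X ^ c * suc (6 * c) * b ^ (5 * c + 25) ≤ b ^ (30 * c) * Y ^ c →
  X ^ suc c * suc (6 * suc c) * b ^ (5 * suc c + 25) ≤ b ^ (30 * suc c) * Y ^ suc c
growth-step X Y b ratio c c≥1 IH = begin
  X ^ suc c * suc (6 * suc c) * b ^ (5 * suc c + 25)
    ≡⟨ cong (λ e → X ^ suc c * suc (6 * suc c) * b ^ e) (exp₅ c) ⟩
  X * X ^ c * suc (6 * suc c) * b ^ (5 + (5 * c + 25))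
    ≡⟨ cong (X * X ^ c * suc (6 * suc c) *_) (^-distribˡ-+-* b 5 (5 * c + 25)) ⟩
  X * X ^ c * suc (6 * suc c) * (b ^ 5 * b ^ (5 * c + 25))
    ≤⟨ *-monoˡ-≤ (b ^ 5 * b ^ (5 * c + 25)) (*-monoʳ-≤ (X * X ^ c) linear) ⟩
  X * X ^ c * (2 * suc (6 * c)) * (b ^ 5 * b ^ (5 * c + 25))
    ≡⟨ regroup X (X ^ c) (suc (6 * c)) (b ^ 5) (b ^ (5 * c + 25)) ⟩
  (2 * X * b ^ 5) * (X ^ c * suc (6 * c) * b ^ (5 * c + 25))
    ≤⟨ *-mono-≤ ratio IH ⟩
  (b ^ 30 * Y) * (b ^ (30 * c) * Y ^ c)
    ≡⟨ interchange (b ^ 30) Y (b ^ (30 * c)) (Y ^ c) ⟩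
  b ^ 30 * b ^ (30 * c) * Y ^ suc c
    ≡⟨ cong (_* Y ^ suc c) (^-distribˡ-+-* b 30 (30 * c)) ⟨
  b ^ (30 + 30 * c) * Y ^ suc c
    ≡⟨ cong (λ e → b ^ e * Y ^ suc c) (exp₃₀ c) ⟩
  b ^ (30 * suc c) * Y ^ suc c ∎
  where
  open ≤-Reasoning
  exp₅ : ∀ c → 5 * suc c + 25 ≡ 5 + (5 * c + 25)
  exp₅ = solve-∀
  exp₃₀ : ∀ c → 30 + 30 * c ≡ 30 * suc c
  exp₃₀ = solve-∀
  regroup : ∀ X Xc s F W → X * Xc * (2 * s) * (F * W) ≡ (2 * X * F) * (Xc * s * W)
  regroup = solve-∀
  interchange : ∀ F D G H → F * D * (G * H) ≡ F * G * (D * H)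
  interchange = solve-∀
  linear : suc (6 * suc c) ≤ 2 * suc (6 * c)
  linear = begin
    suc (6 * suc c)     ≡⟨ expand c ⟩
    2 + (5 + 6 * c)     ≤⟨ +-monoʳ-≤ 2 (+-monoˡ-≤ (6 * c) (≤-trans (n≤1+n 5) (*-monoʳ-≤ 6 c≥1))) ⟩
    2 + (6 * c + 6 * c) ≡⟨ collect c ⟩
    2 * suc (6 * c)     ∎
    where
    expand : ∀ c → suc (6 * suc c) ≡ 2 + (5 + 6 * c)
    expand = solve-∀
    collect : ∀ c → 2 + (6 * c + 6 * c) ≡ 2 * suc (6 * c)
    collect = solve-∀

opaque
  unfolding Num Den

  growth-ratio : 2 * Num * 4 ^ 5 ≤ 4 ^ 30 * Den
  growth-ratio = ≤ᵇ⇒≤ _ _ tt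

  growth-base : Num ^ 6 * suc (6 * 6) * 4 ^ (5 * 6 + 25) ≤ 4 ^ (30 * 6) * Den ^ 6
  growth-base = ≤ᵇ⇒≤ _ _ tt

-- Num / Den < 4^25 per unit, with enough room to absorb the factor 6c + 1.
growth : ∀ c → 6 ≤ c → Num ^ c * suc (6 * c) * 4 ^ (5 * c + 25) ≤ 4 ^ (30 * c) * Den ^ c
growth (suc c) 6≤sc with m≤n⇒m<n∨m≡n 6≤sc
... | inj₂ refl = growth-base
... | inj₁ 6<sc = growth-step Num Den 4 growth-ratio c (≤-trans (s≤s z≤n) 6≤c) (growth c 6≤c)
  where
  6≤c : 6 ≤ c
  6≤c = ≤-pred 6<sc

-- The constant of Chebyshev's bound, large enough for the cases 30c ≤ 150.
opaque
  K : ℕ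
  K = 150 ^ 150

opaque
  unfolding K

  K-large : ∀ x → 150 ^ 150 ≤ K * 4 ^ x
  K-large x = m≤m*n (150 ^ 150) (4 ^ x) {{m^n≢0 4 x}}

  K≥1 : 1 ≤ K * 4 ^ 0
  K≥1 = ≤ᵇ⇒≤ 1 _ tt

Ψ-bound-small : ∀ c N → 1 ≤ c → c ≤ 5 → 30 * c ≤ N → Ψ (30 * c) N ≤ K * 4 ^ (30 * c)
Ψ-bound-small c N c≥1 c≤5 30c≤N = begin
  Ψ (30 * c) N          ≤⟨ Ψ≤x^x (30 * c) N (≤-trans c≥1 (m≤n*m c 30)) 30c≤N ⟩
  (30 * c) ^ (30 * c)   ≤⟨ ^-monoˡ-≤ (30 * c) (*-monoʳ-≤ 30 c≤5) ⟩
  150 ^ (30 * c)        ≤⟨ ^-monoʳ-≤ 150 (*-monoʳ-≤ 30 c≤5) ⟩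
  150 ^ 150             ≤⟨ K-large (30 * c) ⟩
  K * 4 ^ (30 * c)      ∎
  where open ≤-Reasoning

-- The recursion of Chebyshev's bound goes from c to ⌈c/6⌉.
sixth : ℕ → ℕ
sixth c = (c + 5) / 6

sixth-bounds : ∀ c → 6 ≤ c → sixth c < c × 5 * c ≤ 30 * sixth c × 30 * sixth c ≤ 5 * c + 25
sixth-bounds c 6≤c = c'<c , 5c≤30c' , 30c'≤5c+25
  where
  c' = sixth c
  c'*6≤c+5 : c' * 6 ≤ c + 5
  c'*6≤c+5 = m/n*n≤m (c + 5) 6
  c≤c'*6 : c ≤ c' * 6
  c≤c'*6 = +-cancelʳ-≤ 5 c (c' * 6) (begin
    c + 5                     ≡⟨ m≡m%n+[m/n]*n (c + 5) 6 ⟩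
    (c + 5) % 6 + c' * 6      ≤⟨ +-monoˡ-≤ (c' * 6) (≤-pred (m%n<n (c + 5) 6)) ⟩
    5 + c' * 6                ≡⟨ +-comm 5 (c' * 6) ⟩
    c' * 6 + 5                ∎)
    where open ≤-Reasoning
  times30 : ∀ x → 5 * (x * 6) ≡ 30 * x
  times30 = solve-∀
  5c≤30c' : 5 * c ≤ 30 * c'
  5c≤30c' = ≤-trans (*-monoʳ-≤ 5 c≤c'*6) (≤-reflexive (times30 c'))
  30c'≤5c+25 : 30 * c' ≤ 5 * c + 25
  30c'≤5c+25 = ≤-trans (≤-reflexive (sym (times30 c'))) (≤-trans (*-monoʳ-≤ 5 c'*6≤c+5) (≤-reflexive (expand c)))
    where
    expand : ∀ c → 5 * (c + 5) ≡ 5 * c + 25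
    expand = solve-∀
  c'<c : c' < c
  c'<c = *-cancelʳ-< 6 c' c (begin-strict
    c' * 6     ≤⟨ c'*6≤c+5 ⟩
    c + 5      <⟨ +-monoʳ-< c (≤-trans 6≤c (m≤n*m c 5)) ⟩
    c + 5 * c  ≡⟨ six c ⟩
    c * 6      ∎)
    where
    open ≤-Reasoning
    six : ∀ c → c + 5 * c ≡ c * 6
    six = solve-∀

-- The recursive step: Ψ(30c) ≤ Γ(30c) Ψ(30⌈c/6⌉), Γ(30c) ≤ Num^c (6c+1) / Den^c
-- and the growth inequality give Ψ(30c) ≤ K 4^(30c) from the bound at ⌈c/6⌉.
Ψ-bound-step : ∀ c N → 6 ≤ c → 30 * c ≤ N → Ψ (30 * sixth c) N ≤ K * 4 ^ (30 * sixth c) → Ψ (30 * c) N ≤ K * 4 ^ (30 * c)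
Ψ-bound-step c N 6≤c 30c≤N IH = *-cancelʳ-≤ _ _ (Den ^ c) {{m^n≢0 Den c {{Den≢0}}}} (begin
  Ψ (30 * c) N * Den ^ c                          ≤⟨ *-monoˡ-≤ (Den ^ c) (Ψ-recursion c N) ⟩
  g * Ψ (5 * c) N * Den ^ c                       ≤⟨ *-monoˡ-≤ (Den ^ c) (*-monoʳ-≤ g (≤-trans (Ψ-mono N 5c≤30c') IH)) ⟩
  g * (K * 4 ^ (30 * c')) * Den ^ c               ≡⟨ regroup g K (4 ^ (30 * c')) (Den ^ c) ⟩
  g * Den ^ c * (K * 4 ^ (30 * c'))               ≤⟨ *-mono-≤ (Γ-upper c N (≤-trans (s≤s z≤n) 6≤c) 30c≤N) (*-monoʳ-≤ K (^-monoʳ-≤ 4 30c'≤5c+25)) ⟩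
  Num ^ c * suc (6 * c) * (K * 4 ^ (5 * c + 25))  ≡⟨ regroup′ (Num ^ c) (suc (6 * c)) K (4 ^ (5 * c + 25)) ⟩
  K * (Num ^ c * suc (6 * c) * 4 ^ (5 * c + 25))  ≤⟨ *-monoʳ-≤ K (growth c 6≤c) ⟩
  K * (4 ^ (30 * c) * Den ^ c)                    ≡⟨ *-assoc K _ _ ⟨
  K * 4 ^ (30 * c) * Den ^ c                      ∎)
  where
  open ≤-Reasoning
  g = Γ (30 * c) N
  c' = sixth c
  5c≤30c' = proj₁ (proj₂ (sixth-bounds c 6≤c))
  30c'≤5c+25 = proj₂ (proj₂ (sixth-bounds c 6≤c))
  regroup : ∀ g C F D → g * (C * F) * D ≡ g * D * (C * F)
  regroup = solve-∀
  regroup′ : ∀ U s C F → U * s * (C * F) ≡ C * (U * s * F)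
  regroup′ = solve-∀

-- Chebyshev's bound Ψ(30c) ≤ K · 4^(30c), by well-founded recursion (fuel k ≥ c).
Ψ-bound-30 : ∀ k c N → c ≤ k → 30 * c ≤ N → Ψ (30 * c) N ≤ K * 4 ^ (30 * c)
Ψ-bound-30 k zero N _ _ rewrite Ψ-zero N = K≥1
Ψ-bound-30 zero (suc c) N () _
Ψ-bound-30 (suc k) (suc c) N sc≤sk 30c≤N with suc c ≤? 5
... | yes sc≤5 = Ψ-bound-small (suc c) N (s≤s z≤n) sc≤5 30c≤N
... | no sc≰5 = Ψ-bound-step (suc c) N 6≤sc 30c≤N (Ψ-bound-30 k (sixth (suc c)) N c'≤k (≤-trans 30c'≤5c+25 5c+25≤N))
  where
  6≤sc : 6 ≤ suc c
  6≤sc = ≰⇒> sc≰5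
  c'≤k : sixth (suc c) ≤ k
  c'≤k = ≤-pred (≤-trans (proj₁ (sixth-bounds (suc c) 6≤sc)) sc≤sk)
  30c'≤5c+25 = proj₂ (proj₂ (sixth-bounds (suc c) 6≤sc))
  5c+25≤N : 5 * suc c + 25 ≤ N
  5c+25≤N = ≤-trans (+-monoʳ-≤ (5 * suc c) (*-monoʳ-≤ 25 (s≤s z≤n))) (≤-trans (≤-reflexive (thirty (suc c))) 30c≤N)
    where
    thirty : ∀ c → 5 * c + 25 * c ≡ 30 * c
    thirty = solve-∀

Ψ-bound : ∀ x N → x + 29 ≤ N → Ψ x N ≤ K * 4 ^ (x + 29)
Ψ-bound x N x+29≤N = begin
  Ψ x N              ≤⟨ Ψ-mono N x≤30c ⟩
  Ψ (30 * c) N       ≤⟨ Ψ-bound-30 c c N ≤-refl (≤-trans 30c≤x+29 x+29≤N) ⟩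
  K * 4 ^ (30 * c)   ≤⟨ *-monoʳ-≤ K (^-monoʳ-≤ 4 30c≤x+29) ⟩
  K * 4 ^ (x + 29)   ∎
  where
  open ≤-Reasoning
  c = (x + 29) / 30
  30c≤x+29 : 30 * c ≤ x + 29
  30c≤x+29 = ≤-trans (≤-reflexive (*-comm 30 c)) (m/n*n≤m (x + 29) 30)
  x≤30c : x ≤ 30 * c
  x≤30c = +-cancelʳ-≤ 29 x (30 * c) (begin
    x + 29                 ≡⟨ m≡m%n+[m/n]*n (x + 29) 30 ⟩
    (x + 29) % 30 + c * 30 ≤⟨ +-monoˡ-≤ (c * 30) (≤-pred (m%n<n (x + 29) 30)) ⟩
    29 + c * 30            ≡⟨ trans (+-comm 29 (c * 30)) (cong (_+ 29) (*-comm c 30)) ⟩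
    30 * c + 29            ∎)

-- Counting the powers of a prime Q = 2 + q that are ≤ x.  If Q ≤ s and
-- ⌊x/Q⌋ ≤ y, the first power is counted among those ≤ s, the others among those ≤ y.
count-split : ∀ q x y s B → 2 + q ≤ s → x / (2 + q) ≤ y →
  adicSum positive (2 + q) x (suc B) ≤ adicSum positive (2 + q) y (suc B) + adicSum positive (2 + q) s (suc B)
count-split q x y s B Q≤s x/Q≤y = begin
  positive (x / Q) + adicSum positive Q (x / Q) B
    ≤⟨ +-mono-≤ first (≤-trans (adicSum-monoᵐ positive Q _ _ B positive-mono x/Q≤y) (adicSum-monoᴮ positive Q y B)) ⟩
  adicSum positive Q s (suc B) + adicSum positive Q y (suc B)
    ≡⟨ +-comm (adicSum positive Q s (suc B)) _ ⟩
  adicSum positive Q y (suc B) + adicSum positive Q s (suc B) ∎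
  where
  open ≤-Reasoning
  Q = 2 + q
  first : positive (x / Q) ≤ adicSum positive Q s (suc B)
  first with s / Q in s/Q≡
  ... | zero = ⊥-elim (<-irrefl refl (<-≤-trans (m/n≡0⇒m<n s/Q≡) Q≤s))
  ... | suc _ = ≤-trans (positive≤1 (x / Q)) (m≤m+n 1 _)

-- If Q² > x, only Q itself can be counted, and it is counted for y as soon as Q ≤ x ⇒ Q ≤ y.
count-single : ∀ q x y B → x < (2 + q) * (2 + q) → (2 + q ≤ x → 2 + q ≤ y) →
  adicSum positive (2 + q) x (suc B) ≤ adicSum positive (2 + q) y (suc B)
count-single q x y B x<Q² Q≤x⇒Q≤y = begin
  positive (x / Q) + adicSum positive Q (x / Q) B  ≡⟨ cong (positive (x / Q) +_) (adicSum-small positive Q (x / Q) B refl (m<n*o⇒m/o<n x<Q²)) ⟩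
  positive (x / Q) + 0                             ≤⟨ +-mono-≤ first z≤n ⟩
  positive (y / Q) + adicSum positive Q (y / Q) B  ∎
  where
  open ≤-Reasoning
  Q = 2 + q
  first : positive (x / Q) ≤ positive (y / Q)
  first with x / Q in x/Q≡
  ... | zero = z≤n
  ... | suc _ = positive-mono (m≥n⇒m/n>0 (Q≤x⇒Q≤y (m/n≢0⇒n≤m (λ x/Q≡0 → 0≢1+n (trans (sym x/Q≡0) x/Q≡)))))

-- If no prime lies in (4n, 5n], the primes powers ≤ 5n are those ≤ 4n together with
-- the first powers of primes ≤ √(5n):  Ψ(5n) ≤ Ψ(4n) · Ψ(⌊√(5n)⌋).
Ψ-gap : ∀ n s N → 1 ≤ N → s * s ≤ 5 * n → 5 * n < suc s * suc s →
  (∀ q → Prime q → q ≤ 5 * n → q ≤ 4 * n) → Ψ (5 * n) N ≤ Ψ (4 * n) N * Ψ s N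
Ψ-gap n s (suc N) _ s²≤5n 5n<[s+1]² gap = ≤-trans (primeProduct-mono _ _ (suc N) exponents) (≤-reflexive (primeProduct-+ _ _ (suc N)))
  where
  exponents : ∀ q → Prime q → adicSum positive q (5 * n) (suc N) ≤ adicSum positive q (4 * n) (suc N) + adicSum positive q s (suc N)
  exponents Q pQ with prime⇒2+ pQ
  ... | q , refl with Q * Q ≤? 5 * n
  ...   | yes Q²≤5n = count-split q (5 * n) (4 * n) s N Q≤s 5n/Q≤4n
    where
    Q≤s : Q ≤ s
    Q≤s with Q ≤? s
    ... | yes Q≤s = Q≤s
    ... | no Q≰s = ⊥-elim (<-irrefl refl (<-≤-trans 5n<[s+1]² (≤-trans (*-mono-≤ (≰⇒> Q≰s) (≰⇒> Q≰s)) Q²≤5n)))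
    5n/Q≤4n : 5 * n / Q ≤ 4 * n
    5n/Q≤4n = *-cancelʳ-≤ _ _ 2 (begin
      5 * n / Q * 2 ≤⟨ *-monoʳ-≤ (5 * n / Q) (s≤s (s≤s z≤n)) ⟩
      5 * n / Q * Q ≤⟨ m/n*n≤m (5 * n) Q ⟩
      5 * n         ≤⟨ *-monoˡ-≤ n (≤ᵇ⇒≤ 5 8 tt) ⟩
      8 * n         ≡⟨ double n ⟩
      4 * n * 2     ∎)
      where
      open ≤-Reasoning
      double : ∀ n → 8 * n ≡ 4 * n * 2
      double = solve-∀
  ...   | no Q²≰5n = ≤-trans (count-single q (5 * n) (4 * n) N (≰⇒> Q²≰5n) (gap Q pQ)) (m≤m+n _ _)

isqrt : ∀ M → Σ ℕ (λ s → s * s ≤ M × M < suc s * suc s)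
isqrt zero = 0 , z≤n , s≤s z≤n
isqrt (suc M) with isqrt M
... | s , s²≤M , M<[s+1]² with suc s * suc s ≤? suc M
...   | no [s+1]²≰sM = s , m≤n⇒m≤1+n s²≤M , ≰⇒> [s+1]²≰sM
...   | yes [s+1]²≤sM = suc s , [s+1]²≤sM ,
          subst (_< suc (suc s) * suc (suc s)) (sym (≤-antisym M<[s+1]² [s+1]²≤sM)) (*-mono-< (n<1+n (suc s)) (n<1+n (suc s)))

-- The subexponential factors collected in the final comparison, for j = ⌊n/90⌋:
-- the polynomial factors of Γ-lower (at a = 15j) and Γ-upper (at 12(j+1) and
-- 2(j+1)), and the two applications of Chebyshev's bound.
remainder : ℕ → ℕ
remainder j = suc (30 * (15 * j)) * suc (15 * (15 * j)) * suc (6 * (12 * suc j)) * suc (6 * (2 * suc j))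
            * (K * 4 ^ (5 * (2 * suc j) + 29)) * (K * 4 ^ (j + 29))

linear-doubles : ∀ c k j → 1 ≤ j → suc (c * (k * suc j)) ≤ 2 * suc (c * (k * j))
linear-doubles c k j j≥1 = begin
  suc (c * (k * suc j))                 ≡⟨ cong suc (expand c k j) ⟩
  suc (c * k + c * (k * j))             ≤⟨ s≤s (+-monoˡ-≤ (c * (k * j)) (*-monoʳ-≤ c k≤kj)) ⟩
  suc (c * (k * j) + c * (k * j))       ≤⟨ n≤1+n _ ⟩
  suc (suc (c * (k * j) + c * (k * j))) ≡⟨ double (c * (k * j)) ⟩
  2 * suc (c * (k * j))                 ∎
  where
  open ≤-Reasoning
  expand : ∀ c k j → c * (k * suc j) ≡ c * k + c * (k * j)
  expand = solve-∀
  double : ∀ x → suc (suc (x + x)) ≡ 2 * suc x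
  double = solve-∀
  k≤kj : k ≤ k * j
  k≤kj = ≤-trans (≤-reflexive (sym (*-identityʳ k))) (*-monoʳ-≤ k j≥1)

product-growth : ∀ A B C D A′ B′ C′ D′ K F X Y M → 16 * F * 4 ≡ M →
  A′ ≤ 2 * A → B′ ≤ 2 * B → C′ ≤ 2 * C → D′ ≤ 2 * D →
  A′ * B′ * C′ * D′ * (K * (F * X)) * (K * (4 * Y)) ≤ M * (A * B * C * D * (K * X) * (K * Y))
product-growth A B C D A′ B′ C′ D′ K F X Y M M≡ A′≤ B′≤ C′≤ D′≤ = begin
  A′ * B′ * C′ * D′ * (K * (F * X)) * (K * (4 * Y))
    ≤⟨ *-monoˡ-≤ (K * (4 * Y)) (*-monoˡ-≤ (K * (F * X)) (*-mono-≤ (*-mono-≤ (*-mono-≤ A′≤ B′≤) C′≤) D′≤)) ⟩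
  2 * A * (2 * B) * (2 * C) * (2 * D) * (K * (F * X)) * (K * (4 * Y))
    ≡⟨ regroup A B C D K F X Y ⟩
  16 * F * 4 * (A * B * C * D * (K * X) * (K * Y))
    ≡⟨ cong (_* (A * B * C * D * (K * X) * (K * Y))) M≡ ⟩
  M * (A * B * C * D * (K * X) * (K * Y)) ∎
  where
  open ≤-Reasoning
  regroup : ∀ A B C D K F X Y →
    2 * A * (2 * B) * (2 * C) * (2 * D) * (K * (F * X)) * (K * (4 * Y)) ≡ 16 * F * 4 * (A * B * C * D * (K * X) * (K * Y))
  regroup = solve-∀

opaque
  ρ : ℕ
  ρ = 16 * 4 ^ 10 * 4

  ρ-unfold : 16 * 4 ^ 10 * 4 ≡ ρ
  ρ-unfold = refl

  ρ≢0 : NonZero ρ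
  ρ≢0 = _

remainder-step : ∀ j → 1 ≤ j → remainder (suc j) ≤ ρ * remainder j
remainder-step j j≥1 = subst (_≤ ρ * remainder j) (cong (λ z → A′ * B′ * C′ * D′ * (K * z) * (K * (4 * Y))) X′≡)
  (product-growth A B C D A′ B′ C′ D′ K (4 ^ 10) X Y ρ ρ-unfold
    (linear-doubles 30 15 j j≥1) (linear-doubles 15 15 j j≥1) (linear-doubles 6 12 (suc j) (s≤s z≤n)) (linear-doubles 6 2 (suc j) (s≤s z≤n)))
  where
  A = suc (30 * (15 * j))
  B = suc (15 * (15 * j))
  C = suc (6 * (12 * suc j))
  D = suc (6 * (2 * suc j))
  A′ = suc (30 * (15 * suc j))
  B′ = suc (15 * (15 * suc j))
  C′ = suc (6 * (12 * suc (suc j)))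
  D′ = suc (6 * (2 * suc (suc j)))
  X = 4 ^ (5 * (2 * suc j) + 29)
  Y = 4 ^ (j + 29)
  X′≡ : 4 ^ 10 * X ≡ 4 ^ (5 * (2 * suc (suc j)) + 29)
  X′≡ = trans (sym (^-distribˡ-+-* 4 10 (5 * (2 * suc j) + 29))) (cong (4 ^_) (exponent j))
    where
    exponent : ∀ j → 10 + (5 * (2 * suc j) + 29) ≡ 5 * (2 * suc (suc j)) + 29
    exponent = solve-∀

opaque
  unfolding Num Den K ρ

  remainder-base : Den ^ 435 * remainder 449 < Num ^ 435
  remainder-base = ≤ᵇ⇒≤ _ _ tt

  Den*ρ≤Num : Den * ρ ≤ Num
  Den*ρ≤Num = ≤ᵇ⇒≤ _ _ tt

-- Since Den · ρ ≤ Num, the exponential Num^t outgrows Den^t · remainder: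
-- Den^(j-14) · remainder j < Num^(j-14) for all j ≥ 449.
remainder-small : ∀ j → 449 ≤ j → Den ^ (j ∸ 14) * remainder j < Num ^ (j ∸ 14)
remainder-small j 449≤j = subst₂ (λ t i → Den ^ t * remainder i < Num ^ t) t≡ i≡ (shifted (j ∸ 449))
  where
  shifted : ∀ t → Den ^ (t + 435) * remainder (t + 449) < Num ^ (t + 435)
  shifted zero = remainder-base
  shifted (suc t) = begin-strict
    Den * Dt * remainder (suc (t + 449))  ≤⟨ *-monoʳ-≤ (Den * Dt) (remainder-step (t + 449) (≤-trans (s≤s z≤n) (m≤n+m 449 t))) ⟩
    Den * Dt * (ρ * remainder (t + 449))  ≡⟨ regroup Den Dt ρ (remainder (t + 449)) ⟩
    Den * ρ * (Dt * remainder (t + 449))  <⟨ *-monoʳ-< (Den * ρ) {{m*n≢0 Den ρ {{Den≢0}} {{ρ≢0}}}} (shifted t) ⟩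
    Den * ρ * Num ^ (t + 435)             ≤⟨ *-monoˡ-≤ (Num ^ (t + 435)) Den*ρ≤Num ⟩
    Num * Num ^ (t + 435)                 ∎
    where
    open ≤-Reasoning
    Dt = Den ^ (t + 435)
    regroup : ∀ D Dt M R → D * Dt * (M * R) ≡ D * M * (Dt * R)
    regroup = solve-∀
  i≡ : (j ∸ 449) + 449 ≡ j
  i≡ = m∸n+n≡m 449≤j
  t≡ : (j ∸ 449) + 435 ≡ j ∸ 14
  t≡ = begin
    (j ∸ 449) + 435        ≡⟨ m+n∸n≡m ((j ∸ 449) + 435) 14 ⟨
    (j ∸ 449) + 435 + 14 ∸ 14 ≡⟨ cong (_∸ 14) (+-assoc (j ∸ 449) 435 14) ⟩
    (j ∸ 449) + 449 ∸ 14   ≡⟨ cong (_∸ 14) i≡ ⟩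
    j ∸ 14                 ∎
    where open ≡-Reasoning

index-split : ∀ j → 14 ≤ j → 15 * j ≡ 12 * suc j + 2 * suc j + (j ∸ 14)
index-split j 14≤j = begin
  15 * j                                   ≡⟨ cong (15 *_) (m∸n+n≡m 14≤j) ⟨
  15 * (t + 14)                            ≡⟨ split t ⟩
  12 * suc (t + 14) + 2 * suc (t + 14) + t ≡⟨ cong (λ z → 12 * suc z + 2 * suc z + t) (m∸n+n≡m 14≤j) ⟩
  12 * suc j + 2 * suc j + t               ∎
  where
  open ≡-Reasoning
  t = j ∸ 14
  split : ∀ t → 15 * (t + 14) ≡ 12 * suc (t + 14) + 2 * suc (t + 14) + t
  split = solve-∀

-- For a = 15j = b₁ + b₂ + t with b₁ = 12(j+1), b₂ = 2(j+1)
-- and t = j - 14, the bounds of Γ-lower and Γ-upper turn a bound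
--   Γ(30a) ≤ Γ(30b₁) · Γ(30b₂) · (subexponential)
-- into Num^t ≤ Den^t · remainder j, contradicting remainder-small.
Γ-squeeze : ∀ j N → 449 ≤ j → 30 * (15 * j) ≤ N → 30 * (12 * suc j) ≤ N →
  Γ (30 * (15 * j)) N ≤ Γ (30 * (12 * suc j)) N * (Γ (30 * (2 * suc j)) N * (K * 4 ^ (5 * (2 * suc j) + 29))) * (K * 4 ^ (j + 29)) → ⊥
Γ-squeeze j N 449≤j 30a≤N 30b₁≤N Γ-bound = <-irrefl refl (<-≤-trans (remainder-small j 449≤j) Num^t≤)
  where
  a = 15 * j
  b₁ = 12 * suc j
  b₂ = 2 * suc j
  t = j ∸ 14
  30b₂≤N : 30 * b₂ ≤ N
  30b₂≤N = ≤-trans (*-monoʳ-≤ 30 (*-monoˡ-≤ (suc j) (≤ᵇ⇒≤ 2 12 tt))) 30b₁≤N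
  Γ₁ = Γ (30 * b₁) N
  Γ₂ = Γ (30 * b₂) N
  S₁ = suc (30 * a)
  S₂ = suc (15 * a)
  s₁ = suc (6 * b₁)
  s₂ = suc (6 * b₂)
  X₈ = K * 4 ^ (5 * b₂ + 29)
  X₉ = K * 4 ^ (j + 29)
  U₁ = Num ^ b₁
  U₂ = Num ^ b₂
  powers : ∀ x → x ^ a ≡ x ^ b₁ * x ^ b₂ * x ^ t
  powers x = trans (cong (x ^_) (index-split j (≤-trans (≤ᵇ⇒≤ 14 449 tt) 449≤j))) (trans (^-distribˡ-+-* x (b₁ + b₂) t) (cong (_* x ^ t) (^-distribˡ-+-* x b₁ b₂)))
  main : U₁ * U₂ * Num ^ t ≤ U₁ * U₂ * (Den ^ t * remainder j)
  main = begin
    U₁ * U₂ * Num ^ t                                          ≡⟨ powers Num ⟨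
    Num ^ a                                                    ≤⟨ Γ-lower a N (≤-trans (≤ᵇ⇒≤ 1 6735 tt) (*-monoʳ-≤ 15 449≤j)) 30a≤N ⟩
    S₁ * S₂ * (Γ (30 * a) N * Den ^ a)                         ≤⟨ *-monoʳ-≤ (S₁ * S₂) (*-monoˡ-≤ (Den ^ a) Γ-bound) ⟩
    S₁ * S₂ * (Γ₁ * (Γ₂ * X₈) * X₉ * Den ^ a)                  ≡⟨ cong (λ z → S₁ * S₂ * (Γ₁ * (Γ₂ * X₈) * X₉ * z)) (powers Den) ⟩
    S₁ * S₂ * (Γ₁ * (Γ₂ * X₈) * X₉ * (Den ^ b₁ * Den ^ b₂ * Den ^ t))
      ≡⟨ regroup S₁ S₂ Γ₁ Γ₂ X₈ X₉ (Den ^ b₁) (Den ^ b₂) (Den ^ t) ⟩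
    (Γ₁ * Den ^ b₁) * (Γ₂ * Den ^ b₂) * (S₁ * S₂ * X₈ * X₉ * Den ^ t)
      ≤⟨ *-monoˡ-≤ (S₁ * S₂ * X₈ * X₉ * Den ^ t) (*-mono-≤ (Γ-upper b₁ N (s≤s z≤n) 30b₁≤N) (Γ-upper b₂ N (s≤s z≤n) 30b₂≤N)) ⟩
    (U₁ * s₁) * (U₂ * s₂) * (S₁ * S₂ * X₈ * X₉ * Den ^ t)      ≡⟨ regroup′ U₁ s₁ U₂ s₂ S₁ S₂ X₈ X₉ (Den ^ t) ⟩
    U₁ * U₂ * (Den ^ t * remainder j)                          ∎
    where
    open ≤-Reasoning
    regroup : ∀ S₁ S₂ Γ₁ Γ₂ X₈ X₉ D₁ D₂ Dt →
      S₁ * S₂ * (Γ₁ * (Γ₂ * X₈) * X₉ * (D₁ * D₂ * Dt)) ≡ (Γ₁ * D₁) * (Γ₂ * D₂) * (S₁ * S₂ * X₈ * X₉ * Dt)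
    regroup = solve-∀
    regroup′ : ∀ U₁ s₁ U₂ s₂ S₁ S₂ X₈ X₉ Dt →
      (U₁ * s₁) * (U₂ * s₂) * (S₁ * S₂ * X₈ * X₉ * Dt) ≡ U₁ * U₂ * (Dt * (S₁ * S₂ * s₁ * s₂ * X₈ * X₉))
    regroup′ = solve-∀
  Num^t≤ : Num ^ t ≤ Den ^ t * remainder j
  Num^t≤ = *-cancelˡ-≤ (U₁ * U₂) {{m*n≢0 U₁ U₂ {{m^n≢0 Num b₁ {{Num≢0}}}} {{m^n≢0 Num b₂ {{Num≢0}}}}}} main

-- If (4n, 5n] contains no prime, the estimates for Ψ and Γ chain together:
--   Γ(30a) ≤ Ψ(5n) ≤ Ψ(4n) Ψ(s) ≤ Ψ(30b₁) · K 4^(j+29) ≤ Γ(30b₁) Γ(30b₂) Ψ(5b₂) · K 4^(j+29)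
-- for a = 15j, b₁ = 12(j+1), b₂ = 2(j+1) and s = ⌊√(5n)⌋ ≤ j.
Γ-chain : ∀ n s j N → (∀ q → Prime q → q ≤ 5 * n → q ≤ 4 * n) → 1 ≤ N →
  s * s ≤ 5 * n → 5 * n < suc s * suc s → s ≤ j → s + 29 ≤ N →
  30 * (15 * j) ≤ 5 * n → 4 * n ≤ 30 * (12 * suc j) → 5 * (2 * suc j) + 29 ≤ N →
  Γ (30 * (15 * j)) N ≤ Γ (30 * (12 * suc j)) N * (Γ (30 * (2 * suc j)) N * (K * 4 ^ (5 * (2 * suc j) + 29))) * (K * 4 ^ (j + 29))
Γ-chain n s j N gap N≥1 s²≤5n 5n<[s+1]² s≤j s+29≤N 30a≤5n 4n≤30b₁ 5b₂+29≤N = begin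
  Γ (30 * (15 * j)) N                ≤⟨ Γ≤Ψ _ N ⟩
  Ψ (30 * (15 * j)) N                ≤⟨ Ψ-mono N 30a≤5n ⟩
  Ψ (5 * n) N                        ≤⟨ Ψ-gap n s N N≥1 s²≤5n 5n<[s+1]² gap ⟩
  Ψ (4 * n) N * Ψ s N                ≤⟨ *-mono-≤ (Ψ-mono N 4n≤30b₁) (≤-trans (Ψ-bound s N s+29≤N) (*-monoʳ-≤ K (^-monoʳ-≤ 4 (+-monoˡ-≤ 29 s≤j)))) ⟩
  Ψ (30 * b₁) N * X₉                 ≤⟨ *-monoˡ-≤ X₉ (Ψ-recursion b₁ N) ⟩
  Γ₁ * Ψ (5 * b₁) N * X₉             ≡⟨ cong (λ z → Γ₁ * Ψ z N * X₉) (sixfold j) ⟩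
  Γ₁ * Ψ (30 * b₂) N * X₉            ≤⟨ *-monoˡ-≤ X₉ (*-monoʳ-≤ Γ₁ (≤-trans (Ψ-recursion b₂ N) (*-monoʳ-≤ Γ₂ (Ψ-bound (5 * b₂) N 5b₂+29≤N)))) ⟩
  Γ₁ * (Γ₂ * (K * 4 ^ (5 * b₂ + 29))) * X₉ ∎
  where
  open ≤-Reasoning
  b₁ = 12 * suc j
  b₂ = 2 * suc j
  Γ₁ = Γ (30 * b₁) N
  Γ₂ = Γ (30 * b₂) N
  X₉ = K * 4 ^ (j + 29)
  sixfold : ∀ j → 5 * (12 * suc j) ≡ 30 * (2 * suc j)
  sixfold = solve-∀

m<[1+m/n]*n : ∀ m n .{{_ : NonZero n}} → m < suc (m / n) * n
m<[1+m/n]*n m n = begin-strict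
  m                   ≡⟨ m≡m%n+[m/n]*n m n ⟩
  m % n + m / n * n   <⟨ +-monoˡ-< (m / n * n) (m%n<n m n) ⟩
  n + m / n * n       ∎
  where open ≤-Reasoning

√5n≤n/90 : ∀ n s → 40410 ≤ n → s * s ≤ 5 * n → s ≤ n / 90
√5n≤n/90 n s 40410≤n s²≤5n with s ≤? n / 90
... | yes s≤j = s≤j
... | no s≰j = ⊥-elim (<-irrefl refl (≤-<-trans (/-monoˡ-≤ 90 40410≤n) (≤-pred (*-cancelʳ-< (suc j) (suc j) 450 [j+1]²<450[j+1]))))
  where
  j = n / 90
  [j+1]²<450[j+1] : suc j * suc j < 450 * suc j
  [j+1]²<450[j+1] = begin-strict
    suc j * suc j     ≤⟨ *-mono-≤ (≰⇒> s≰j) (≰⇒> s≰j) ⟩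
    s * s             ≤⟨ s²≤5n ⟩
    5 * n             <⟨ *-monoʳ-< 5 (m<[1+m/n]*n n 90) ⟩
    5 * (suc j * 90)  ≡⟨ factor j ⟩
    450 * suc j       ∎
    where
    open ≤-Reasoning
    factor : ∀ j → 5 * (suc j * 90) ≡ 450 * suc j
    factor = solve-∀

-- For n ≥ 40410 the interval (4n, 5n] contains a prime: otherwise Γ-chain, with
-- j = ⌊n/90⌋, s = ⌊√(5n)⌋ and cut-off N = 5n + 400, contradicts Γ-squeeze.
no-gap-large : ∀ n → 40410 ≤ n → (∀ q → Prime q → q ≤ 5 * n → q ≤ 4 * n) → ⊥
no-gap-large n 40410≤n gap = Γ-squeeze j N 449≤j (≤-trans 30a≤5n (m≤m+n (5 * n) 400)) 30b₁≤N
  (Γ-chain n s j N gap (≤-trans (s≤s z≤n) (m≤n+m 400 (5 * n))) s²≤5n 5n<[s+1]² s≤j s+29≤N 30a≤5n 4n≤30b₁ 5b₂+29≤N)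
  where
  j = n / 90
  449≤j : 449 ≤ j
  449≤j = /-monoˡ-≤ 90 40410≤n
  90j≤n : j * 90 ≤ n
  90j≤n = m/n*n≤m n 90
  N = 5 * n + 400
  s = proj₁ (isqrt (5 * n))
  s²≤5n = proj₁ (proj₂ (isqrt (5 * n)))
  5n<[s+1]² = proj₂ (proj₂ (isqrt (5 * n)))
  s≤j = √5n≤n/90 n s 40410≤n s²≤5n
  30a≤5n : 30 * (15 * j) ≤ 5 * n
  30a≤5n = subst (_≤ 5 * n) (factor j) (*-monoʳ-≤ 5 90j≤n)
    where
    factor : ∀ j → 5 * (j * 90) ≡ 30 * (15 * j)
    factor = solve-∀
  4n≤30b₁ : 4 * n ≤ 30 * (12 * suc j)
  4n≤30b₁ = subst (4 * n ≤_) (factor j) (*-monoʳ-≤ 4 (<⇒≤ (m<[1+m/n]*n n 90)))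
    where
    factor : ∀ j → 4 * (suc j * 90) ≡ 30 * (12 * suc j)
    factor = solve-∀
  30b₁≤N : 30 * (12 * suc j) ≤ N
  30b₁≤N = begin
    30 * (12 * suc j)   ≡⟨ factor j ⟩
    4 * (j * 90) + 360  ≤⟨ +-mono-≤ (*-monoʳ-≤ 4 90j≤n) (≤ᵇ⇒≤ 360 400 tt) ⟩
    4 * n + 400         ≤⟨ +-monoˡ-≤ 400 (*-monoˡ-≤ n (≤ᵇ⇒≤ 4 5 tt)) ⟩
    N                   ∎
    where
    open ≤-Reasoning
    factor : ∀ j → 30 * (12 * suc j) ≡ 4 * (j * 90) + 360
    factor = solve-∀
  5b₂+29≤N : 5 * (2 * suc j) + 29 ≤ N
  5b₂+29≤N = begin
    5 * (2 * suc j) + 29 ≡⟨ expand j ⟩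
    10 * j + 39          ≤⟨ +-mono-≤ (*-monoˡ-≤ j (≤ᵇ⇒≤ 10 360 tt)) (≤ᵇ⇒≤ 39 360 tt) ⟩
    360 * j + 360        ≡⟨ expand′ j ⟩
    30 * (12 * suc j)    ≤⟨ 30b₁≤N ⟩
    N                    ∎
    where
    open ≤-Reasoning
    expand : ∀ j → 5 * (2 * suc j) + 29 ≡ 10 * j + 39
    expand = solve-∀
    expand′ : ∀ j → 360 * j + 360 ≡ 30 * (12 * suc j)
    expand′ = solve-∀
  s+29≤N : s + 29 ≤ N
  s+29≤N = +-mono-≤ (≤-trans s≤j (≤-trans (m≤m*n j 90) (≤-trans 90j≤n (m≤n*m n 5)))) (≤ᵇ⇒≤ 29 400 tt)

trialDivision : ℕ → ℕ → ℕ → Bool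
trialDivision n m zero = false
trialDivision n m (suc k) = (n <ᵇ (2 + m) * (2 + m)) ∨ (not (n % (2 + m) ≡ᵇ 0) ∧ trialDivision n (suc m) k)

trialDivision-sound : ∀ n m k → .{{_ : NonTrivial n}} → T (trialDivision n m k) → (2 + m) Rough n → Prime n
trialDivision-sound n m (suc k) check rough with Equivalence.to T-∨ check
... | inj₁ small-square = rough∧square>⇒prime rough (<ᵇ⇒< n _ small-square)
... | inj₂ rest with Equivalence.to T-∧ rest
...   | no-divisor , check′ = trialDivision-sound n (suc m) k check′ (∤⇒rough-suc m∤n rough)
  where
  m∤n : ¬ ((2 + m) ∣ n)
  m∤n m∣n with () ← trans (sym (cong (_≡ᵇ 0) (n∣m⇒m%n≡0 n (2 + m) m∣n))) (Equivalence.to T-not-≡ no-divisor)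

isPrime : ℕ → Bool
isPrime q = (2 ≤ᵇ q) ∧ trialDivision q 0 q

isPrime-sound : ∀ q → T (isPrime q) → Prime q
isPrime-sound q check with Equivalence.to T-∧ check
... | 2≤q , check′ = trialDivision-sound q 0 q {{n>1⇒nonTrivial (≤ᵇ⇒≤ 2 q 2≤q)}} check′ 2-rough

-- A Bertrand-type chain: each prime q of the list serves every n from the current
-- lower bound lo up to ⌊(q - 1)/4⌋ (so 4n < q < 5n), and the next lower bound is one more;
-- the chain must reach 40410.
covers : List ℕ → ℕ → Bool
covers [] lo = 40410 ≤ᵇ lo
covers (q ∷ qs) lo = (q <ᵇ 5 * lo) ∧ isPrime q ∧ covers qs ((q ∸ 1) / 4 + 1)

covers-sound : ∀ qs lo n → T (covers qs lo) → lo ≤ n → n < 40410 → ∃ λ p → Prime p × (4 * n < p × p < 5 * n)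
covers-sound [] lo n reached lo≤n n<40410 = ⊥-elim (<-irrefl refl (<-≤-trans n<40410 (≤-trans (≤ᵇ⇒≤ 40410 lo reached) lo≤n)))
covers-sound (q ∷ qs) lo n check lo≤n n<40410 with Equivalence.to T-∧ check
... | q<5lo , rest with Equivalence.to T-∧ rest
...   | q-prime , check′ with n ≤? (q ∸ 1) / 4
...     | yes n≤q/4 = q , pq , 4n<q , q<5n
  where
  pq : Prime q
  pq = isPrime-sound q q-prime
  q<5n : q < 5 * n
  q<5n = <-≤-trans (<ᵇ⇒< q (5 * lo) q<5lo) (*-monoʳ-≤ 5 lo≤n)
  4n<q : 4 * n < q
  4n<q = begin-strict
    4 * n                ≤⟨ *-monoʳ-≤ 4 n≤q/4 ⟩
    4 * ((q ∸ 1) / 4)    ≡⟨ *-comm 4 ((q ∸ 1) / 4) ⟩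
    (q ∸ 1) / 4 * 4      ≤⟨ m/n*n≤m (q ∸ 1) 4 ⟩
    q ∸ 1                <⟨ ∸-monoʳ-< z<s (<⇒≤ (nonTrivial⇒n>1 q {{prime⇒nonTrivial pq}})) ⟩
    q                    ∎
    where open ≤-Reasoning
...     | no n≰q/4 = covers-sound qs ((q ∸ 1) / 4 + 1) n check′ (≤-trans (≤-reflexive (+-comm _ 1)) (≰⇒> n≰q/4)) n<40410

chain : List ℕ
chain = 13 ∷ 19 ∷ 23 ∷ 29 ∷ 37 ∷ 47 ∷ 59 ∷ 73 ∷ 89 ∷ 113 ∷ 139 ∷ 173 ∷ 211 ∷ 263 ∷ 317 ∷ 397 ∷ 499 ∷ 619 ∷ 773 ∷ 967 ∷
        1201 ∷ 1499 ∷ 1873 ∷ 2341 ∷ 2927 ∷ 3659 ∷ 4567 ∷ 5701 ∷ 7129 ∷ 8893 ∷ 11119 ∷ 13883 ∷ 17351 ∷ 21683 ∷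
        27103 ∷ 33871 ∷ 42337 ∷ 52919 ∷ 66137 ∷ 82657 ∷ 103319 ∷ 129127 ∷ 161407 ∷ 201757 ∷ []

small-cases : ∀ n → 2 < n → n < 40410 → ∃ λ p → Prime p × (4 * n < p × p < 5 * n)
small-cases n 2<n n<40410 = covers-sound chain 3 n tt 2<n n<40410

-- For large n, search (4n, 5n] for a prime; 5n itself is composite.
large-cases : ∀ n → 2 < n → 40410 ≤ n → ∃ λ p → Prime p × (4 * n < p × p < 5 * n)
large-cases n 2<n 40410≤n with anyUpTo? (λ p → (4 * n <? p) ×-dec prime? p) (suc (5 * n))
... | yes (p , p≤5n , 4n<p , pp) with m≤n⇒m<n∨m≡n (≤-pred p≤5n)
...   | inj₁ p<5n = p , pp , 4n<p , p<5n
...   | inj₂ refl = ⊥-elim (5n-composite pp)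
  where
  5n-composite : ¬ Prime (5 * n)
  5n-composite p5n with prime⇒irreducible p5n (divides n (*-comm 5 n))
  ... | inj₁ ()
  ... | inj₂ 5≡5n = <-irrefl 5≡5n (≤-trans (≤ᵇ⇒≤ 6 15 tt) (*-monoʳ-≤ 5 2<n))
large-cases n 2<n 40410≤n | no none = ⊥-elim (no-gap-large n 40410≤n gap)
  where
  gap : ∀ q → Prime q → q ≤ 5 * n → q ≤ 4 * n
  gap q pq q≤5n with q ≤? 4 * n
  ... | yes q≤4n = q≤4n
  ... | no q≰4n = ⊥-elim (none (q , s≤s q≤5n , ≰⇒> q≰4n , pq))

theorem3p3 : ∀ (n : ℕ) → 2 < n → ∃ λ p → Prime p × (4 * n < p × p < 5 * n)
theorem3p3 n 2<n with n <? 40410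
... | yes n<40410 = small-cases n 2<n n<40410
... | no n≮40410 = large-cases n 2<n (≮⇒≥ n≮40410)
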